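{- Let $\alpha=[0;a_1,a_2,\ldots]$ be a slope with continuants $(q_n)_{n\ge-1}$, let $n\ge0$, $0\le l\le a_{n+1}-1$ and $m\ge1$ with $m\in I_n^l$. Then the characteristic word $c_\alpha$ turns $a_{n+1}-l$ times around the referent cycle of the Rauzy graph $G_m$ of $c_\alpha$, and it does not turn $a_{n+1}-l+1$ times around it.
   Context: Slope: irrational $\alpha\in(0,1)$, $\alpha=[0;a_1,a_2,\ldots]$; continuants $q_{ -1}=0,q_0=1,q_{n+1}=a_{n+1}q_n+q_{n-1}$. Standard words $s_{ -1}=1$, $s_0=0$, $s_1=s_0^{a_1-1}s_{ -1}$, $s_{n+1}=s_n^{a_{n+1}}s_{n-1}$; characteristic word $c_\alpha=\lim s_n$ (a sturmian word, i.e. an infinite binary word with exactly $n+1$ factors of length $n$ for all $n\ge1$). $T$ is the shift on infinite words, $\mathbb{P}_m(x)$ the prefix of length $m$ of $x$. Integer intervals: $I_n^0=[q_n-1,q_n+q_{n-1}-2]$ and, for $1\le l\le a_{n+1}-1$, $I_n^l=[lq_n+q_{n-1}-1,(l+1)q_n+q_{n-1}-2]$. The Rauzy graph $G_m$ of an infinite word $x$ is the directed graph whose vertices are the factors of length $m$ of $x$, with an arrow $s\to t$ when some factor of length $m+1$ of $x$ has prefix $s$ and suffix $t$. For a sturmian word and $m\in I_n^l$, $G_m$ is the union of two directed cycles sharing a common path; one of them has length $q_n$ and is called the referent cycle. The repetition function $r(x,m)$ is the largest $k\ge1$ such that $\mathbb{P}_m(x),\mathbb{P}_m(T(x)),\ldots,\mathbb{P}_m(T^{k-1}(x))$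 are pairwise distinct. A word $x$ turns around a cycle $C$ of length $k$ of $G_m$ if $r(x,m)=k$ and the path $\mathbb{P}_m(x)\to\mathbb{P}_m(T(x))\to\cdots\to\mathbb{P}_m(T^k(x))$ uses exactly the arrows of $C$; $x$ turns $d$ times around $C$ if $T^{ik}(x)$ turns around $C$ for every $0\le i\le d-1$. -}

module Defs where

open import Data.Nat using (ℕ; zero; suc; _+_; _*_; _∸_; _≤_; _<_)
open import Data.Bool using (Bool; true; false)
open import Data.List using (List; []; _∷_; _++_; map; take; drop; upTo)
open import Data.Product using (Σ; ∃; _×_; _,_)
open import Relation.Binary.PropositionalEquality using (_≡_)

-- Letters: false = 0, true = 1.  Infinite words are functions ℕ → Bool.
Word : Set
Word = ℕ → Bool

-- A slope α = [0; a₁, a₂, …] is given by its partial quotients a (suc i) ≥ 1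
-- (the value a 0 is irrelevant).  Every such sequence is the expansion of
-- a unique irrational α ∈ (0,1) and conversely.
IsSlope : (ℕ → ℕ) → Set
IsSlope a = ∀ i → 1 ≤ a (suc i)

-- Shifted continuants: qq k = q_{k-1}, so qq 0 = q_{-1} = 0, qq 1 = q_0 = 1,
-- qq (k+2) = a_{k+1} q_k + q_{k-1}.
qq : (ℕ → ℕ) → ℕ → ℕ
qq a 0 = 0
qq a 1 = 1
qq a (suc (suc k)) = a (suc k) * qq a (suc k) + qq a k

q : (ℕ → ℕ) → ℕ → ℕ
q a n = qq a (suc n)

qprev : (ℕ → ℕ) → ℕ → ℕ
qprev a n = qq a n

pow : ℕ → List Bool → List Bool
pow zero w = []
pow (suc k) w = w ++ pow k w

s₋₁ : List Bool
s₋₁ = true ∷ []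

sw : (ℕ → ℕ) → ℕ → List Bool
sw a 0 = false ∷ []
sw a 1 = pow (a 1 ∸ 1) (sw a 0) ++ s₋₁
sw a (suc (suc n)) = pow (a (suc (suc n))) (sw a (suc n)) ++ sw a n

-- i-th letter of a finite word (default false outside range; never used
-- out of range below).
at : List Bool → ℕ → Bool
at [] i = false
at (b ∷ w) zero = b
at (b ∷ w) (suc i) = at w i

-- Characteristic word c_α = lim s_n.  The words s_n (n ≥ 1) are nested
-- prefixes with |s_n| = q_n ≥ n, so the i-th letter of the limit is the
-- i-th letter of s_{i+2}.
charWord : (ℕ → ℕ) → Word
charWord a i = at (sw a (suc (suc i))) i

shift : ℕ → Word → Word
shift i x j = x (i + j)

pre : ℕ → Word → List Bool
pre m x = map x (upTo m)

-- Membership of m in the integer interval I_n^l (written additively to avoid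
-- truncated subtraction):
--   l = 0 :  q_n - 1 ≤ m ≤ q_n + q_{n-1} - 2
--   l ≥ 1 :  l q_n + q_{n-1} - 1 ≤ m ≤ (l+1) q_n + q_{n-1} - 2
InI : (ℕ → ℕ) → ℕ → ℕ → ℕ → Set
InI a n zero m = (q a n ≤ m + 1) × (m + 2 ≤ q a n + qprev a n)
InI a n (suc l) m =
  (suc l * q a n + qprev a n ≤ m + 1) × (m + 2 ≤ suc (suc l) * q a n + qprev a n)

Vertex : Word → ℕ → List Bool → Set
Vertex x m w = ∃ λ i → pre m (shift i x) ≡ w

Arrow : Word → ℕ → List Bool → List Bool → Set
Arrow x m s t = ∃ λ i → let u = pre (suc m) (shift i x) in
  (take m u ≡ s) × (drop 1 u ≡ t)

record Cycle (x : Word) (m : ℕ) : Set where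
  field
    len    : ℕ
    len≥1  : 1 ≤ len
    v      : ℕ → List Bool
    vert   : ∀ j → j < len → Vertex x m (v j)
    inj    : ∀ i j → i < len → j < len → v i ≡ v j → i ≡ j
    arr    : ∀ j → j < len → Arrow x m (v j) (v (suc j))
    closes : v len ≡ v 0

open Cycle public

InCycle : ∀ {x m} → Cycle x m → List Bool → List Bool → Set
InCycle C s t = ∃ λ j → (j < len C) × (s ≡ v C j) × (t ≡ v C (suc j))

DistinctPrefixes : Word → ℕ → ℕ → Set
DistinctPrefixes x m k =
  ∀ i j → i < k → j < k → pre m (shift i x) ≡ pre m (shift j x) → i ≡ j

RepIs : Word → ℕ → ℕ → Set
RepIs x m k = (1 ≤ k) × DistinctPrefixes x m k
  × (∀ k′ → DistinctPrefixes x m k′ → k′ ≤ k)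

InPath : Word → ℕ → ℕ → List Bool → List Bool → Set
InPath x m k s t = ∃ λ i → (i < k) × (s ≡ pre m (shift i x)) × (t ≡ pre m (shift (suc i) x))

TurnsAround : ∀ {y m} → Word → Cycle y m → Set
TurnsAround {m = m} x C = RepIs x m (len C)
  × (∀ s t → InPath x m (len C) s t → InCycle C s t)
  × (∀ s t → InCycle C s t → InPath x m (len C) s t)

TurnsTimes : ∀ {y m} → Word → Cycle y m → ℕ → Set
TurnsTimes x C d = ∀ i → i < d → TurnsAround (shift (i * len C) x) C

module Submission where

open import Defs
open import Data.Nat using (ℕ; suc; _∸_; _≤_; _<_)
open import Data.Product using (Σ; _×_)
open import Relation.Nullary using (¬_)
open import Relation.Binary.PropositionalEquality using (_≡_)

open import Data.Nat as ℕ using (zero; _+_; _*_; z≤n; s≤s; NonZero; >-nonZero; _%_; _/_; _≤?_; _<?_)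
open import Data.Nat.Properties
open import Data.Bool using (Bool; true; false)
open import Data.List using (List; []; _∷_; _++_; take; drop; length; applyUpTo)
open import Data.List.Properties using (length-++; map-upTo; ++-assoc; ++-identityʳ)
open import Data.Product using (∃; _,_; proj₁; proj₂)
open import Data.Sum using (_⊎_; inj₁; inj₂)
open import Relation.Binary.Definitions using (tri<; tri≈; tri>)
open import Data.Empty using (⊥; ⊥-elim)
open import Relation.Nullary using (yes; no)
open import Relation.Binary.PropositionalEquality
  using (refl; sym; trans; cong; cong₂; subst; subst₂; _≢_; module ≡-Reasoning)
open import Function using (_∘_)
open import Data.Nat.Tactic.RingSolver using (solve-∀)
open import Data.Nat.Divisibility using (_∣_; divides; ∣1⇒≡1; ∣m+n∣m⇒∣n; ∣m⇒∣m*n; ∣⇒≤)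
open import Data.Nat.GCD using (module Bézout; module GCD; GCD)
open import Data.Nat.DivMod using (m≡m%n+[m/n]*n; m%n<n; m<n⇒m%n≡m; [m+n]%n≡m%n)

-- Write s = s_n, s' = s_{n-1}, Q = q_n = |s|.  Two facts about standard words drive
-- everything: s_{n+1} s_n and s_n s_{n+1} differ exactly in their last two letters, and
-- s is primitive (|s| and the number of 1s in s are coprime by the determinant identity
-- of the continuants).  The first shows that c_α = s^{a_{n+1}} s' s … agrees with the
-- periodic word s^ω up to the last two letters of s' s and then breaks period Q; the
-- second makes the Q windows of length m ≥ Q - 1 of s^ω pairwise distinct, so they form
-- a cycle of length Q of G_m.  Moreover c_α is covered by blocks s s, s s' s and s' s,
-- so each factor of length Q of c_α is a conjugate of s except one factor, which is
-- followed by s itself; this forces every cycle of length Q of G_m to be the one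
-- formed by the windows of s^ω.  With d = a_{n+1} - l and m ∈ I_n^l, the prefix of c_α
-- of length dQ + m lies inside the periodic part, so c_α turns d times around that
-- cycle, while the break lies within the first m letters of T^{dQ} c_α.

-- Finite words, letters and prefixes

<⊎offset : ∀ N t → t < N ⊎ ∃ λ t′ → t ≡ N + t′
<⊎offset zero t = inj₂ (t , refl)
<⊎offset (suc N) zero = inj₁ (s≤s z≤n)
<⊎offset (suc N) (suc t) with <⊎offset N t
... | inj₁ p = inj₁ (s≤s p)
... | inj₂ (t′ , e) = inj₂ (t′ , cong suc e)

at-++ˡ : ∀ (u v : List Bool) t → t < length u → at (u ++ v) t ≡ at u t
at-++ˡ (x ∷ u) v zero _ = refl
at-++ˡ (x ∷ u) v (suc t) (s≤s p) = at-++ˡ u v t p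

at-++ʳ : ∀ (u v : List Bool) t → at (u ++ v) (length u + t) ≡ at v t
at-++ʳ [] v t = refl
at-++ʳ (x ∷ u) v t = at-++ʳ u v t

at-applyUpTo : ∀ (f : Word) n t → t < n → at (applyUpTo f n) t ≡ f t
at-applyUpTo f (suc n) zero _ = refl
at-applyUpTo f (suc n) (suc t) (s≤s p) = at-applyUpTo (f ∘ suc) n t p

applyUpTo-cong : ∀ (f g : Word) n → (∀ t → t < n → f t ≡ g t) → applyUpTo f n ≡ applyUpTo g n
applyUpTo-cong f g zero h = refl
applyUpTo-cong f g (suc n) h =
  cong₂ _∷_ (h 0 (s≤s z≤n)) (applyUpTo-cong (f ∘ suc) (g ∘ suc) n (λ t p → h (suc t) (s≤s p)))

at-pre : ∀ m (f : Word) t → t < m → at (pre m f) t ≡ f t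
at-pre m f t p = trans (cong (λ l → at l t) (map-upTo f m)) (at-applyUpTo f m t p)

pre-cong : ∀ m (f g : Word) → (∀ t → t < m → f t ≡ g t) → pre m f ≡ pre m g
pre-cong m f g h = trans (map-upTo f m) (trans (applyUpTo-cong f g m h) (sym (map-upTo g m)))

at-≡pre : ∀ m (f : Word) (s : List Bool) → s ≡ pre m f → ∀ t → t < m → at s t ≡ f t
at-≡pre m f s refl t p = at-pre m f t p

pre-≡⇒≡ : ∀ m (f g : Word) → pre m f ≡ pre m g → ∀ t → t < m → f t ≡ g t
pre-≡⇒≡ m f g e t p = trans (sym (at-pre m f t p)) (at-≡pre m g (pre m f) e t p)

at-take : ∀ m (l : List Bool) t → t < m → at (take m l) t ≡ at l t
at-take (suc m) [] t p = refl
at-take (suc m) (x ∷ l) zero p = refl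
at-take (suc m) (x ∷ l) (suc t) (s≤s p) = at-take m l t p

at-drop-1 : ∀ (l : List Bool) t → at (drop 1 l) t ≡ at l (suc t)
at-drop-1 [] t = refl
at-drop-1 (x ∷ l) t = refl

take-pre : ∀ m (f : Word) → take m (pre (suc m) f) ≡ pre m f
take-pre m f = trans (cong (take m) (map-upTo f (suc m))) (trans (go m f) (sym (map-upTo f m)))
  where
  go : ∀ m (f : Word) → take m (applyUpTo f (suc m)) ≡ applyUpTo f m
  go zero f = refl
  go (suc m) f = cong (f 0 ∷_) (go m (f ∘ suc))

drop-pre : ∀ m (f : Word) → drop 1 (pre (suc m) f) ≡ pre m (f ∘ suc)
drop-pre m f = trans (cong (drop 1) (map-upTo f (suc m))) (sym (map-upTo (f ∘ suc) m))

+-swapʳ : ∀ x y z → x + y + z ≡ x + z + y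
+-swapʳ x y z = trans (+-assoc x y z) (trans (cong (x +_) (+-comm y z)) (sym (+-assoc x z y)))

+-swapˡ : ∀ x y z → x + (y + z) ≡ y + (x + z)
+-swapˡ x y z = trans (sym (+-assoc x y z)) (trans (cong (_+ z) (+-comm x y)) (+-assoc y x z))

+-suc-suc : ∀ x y → x + suc (suc y) ≡ suc (suc (x + y))
+-suc-suc x y = trans (+-suc x (suc y)) (cong suc (+-suc x y))

-- Periodic words

Periodic : ℕ → Word → Set
Periodic p F = ∀ t → F (t + p) ≡ F t

periodic-shiftˡ : ∀ {p} (F : Word) → Periodic p F → ∀ k → Periodic p (λ t → F (k + t))
periodic-shiftˡ {p} F P k t = trans (cong F (sym (+-assoc k t p))) (P (k + t))

periodic-shiftʳ : ∀ {p} (F : Word) → Periodic p F → ∀ k → Periodic p (λ t → F (t + k))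
periodic-shiftʳ {p} F P k t = trans (cong F (+-swapʳ t p k)) (P (t + k))

periodic-* : ∀ {p} (F : Word) → Periodic p F → ∀ r t → F (t + r * p) ≡ F t
periodic-* F P zero t = cong F (+-identityʳ t)
periodic-* {p} F P (suc r) t = trans (cong F eq) (trans (P (t + r * p)) (periodic-* F P r t))
  where
  eq : t + (p + r * p) ≡ t + r * p + p
  eq = trans (cong (t +_) (+-comm p (r * p))) (sym (+-assoc t (r * p) p))

module _ {p : ℕ} {{_ : NonZero p}} where

  periodic-%ˡ : ∀ (F : Word) → Periodic p F → ∀ x y → F (x + y) ≡ F (x % p + y)
  periodic-%ˡ F P x y = trans (cong F eq) (periodic-* F P (x / p) (x % p + y))
    where
    eq : x + y ≡ x % p + y + x / p * p
    eq = trans (cong (_+ y) (m≡m%n+[m/n]*n x p)) (+-swapʳ (x % p) (x / p * p) y)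

  periodic-%ʳ : ∀ (F : Word) → Periodic p F → ∀ j z → F (j + z) ≡ F (j + z % p)
  periodic-%ʳ F P j z =
    trans (cong F (+-comm j z)) (trans (periodic-%ˡ F P z j) (cong F (+-comm (z % p) j)))

  periodic-≡ : ∀ (F G : Word) → Periodic p F → Periodic p G →
               ∀ j → (∀ i → i < p → F (j + i) ≡ G (j + i)) → ∀ x → F x ≡ G x
  periodic-≡ F G PF PG j h x = begin
    F x                   ≡⟨ sym (periodic-* F PF j x) ⟩
    F (x + j * p)         ≡⟨ cong F eq ⟩
    F (j + z)             ≡⟨ periodic-%ʳ F PF j z ⟩
    F (j + z % p)         ≡⟨ h (z % p) (m%n<n z p) ⟩
    G (j + z % p)         ≡⟨ sym (periodic-%ʳ G PG j z) ⟩
    G (j + z)             ≡⟨ cong G (sym eq) ⟩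
    G (x + j * p)         ≡⟨ periodic-* G PG j x ⟩
    G x                   ∎
    where
    open ≡-Reasoning
    z : ℕ
    z = x + j * ℕ.pred p
    eq : x + j * p ≡ j + z
    eq = trans (cong (λ k → x + j * k) (sym (suc-pred p))) (trans (cong (x +_) (*-suc j (ℕ.pred p)))
           (+-swapˡ x j (j * ℕ.pred p)))

-- Counting letters 1

bit : Bool → ℕ
bit true = 1
bit false = 0

bit-injective : ∀ x y → bit x ≡ bit y → x ≡ y
bit-injective true true _ = refl
bit-injective false false _ = refl

ones : Word → ℕ → ℕ
ones f zero = 0
ones f (suc n) = ones f n + bit (f n)

ones-cong : ∀ f g n → (∀ i → i < n → f i ≡ g i) → ones f n ≡ ones g n
ones-cong f g zero h = refl
ones-cong f g (suc n) h =
  cong₂ _+_ (ones-cong f g n (λ i p → h i (<-trans p (n<1+n n)))) (cong bit (h n (n<1+n n)))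

ones-+ : ∀ f n k → ones f (n + k) ≡ ones f n + ones (λ i → f (n + i)) k
ones-+ f n zero = trans (cong (ones f) (+-identityʳ n)) (sym (+-identityʳ _))
ones-+ f n (suc k) = trans (cong (ones f) (+-suc n k))
  (trans (cong (_+ bit (f (n + k))) (ones-+ f n k)) (+-assoc (ones f n) _ _))

ones-* : ∀ {p} (F : Word) → Periodic p F → ∀ k → ones F (k * p) ≡ k * ones F p
ones-* F P zero = refl
ones-* {p} F P (suc k) = trans (ones-+ F p (k * p)) (cong (ones F p +_)
  (trans (ones-cong (λ i → F (p + i)) F (k * p) (λ i _ → trans (cong F (+-comm p i)) (P i))) (ones-* F P k)))

ones-rotate : ∀ {p} (F : Word) → Periodic p F → ∀ j → ones (λ i → F (j + i)) p ≡ ones F p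
ones-rotate F P zero = refl
ones-rotate {p} F P (suc j) = trans (+-cancelʳ-≡ (bit (F j)) _ _ eq) (ones-rotate F P j)
  where
  g : Word
  g i = F (j + i)
  eq : ones (λ i → F (suc j + i)) p + bit (F j) ≡ ones g p + bit (F j)
  eq = trans (+-comm _ (bit (F j)))
       (trans (cong₂ _+_ (cong (λ z → bit (F z)) (sym (+-identityʳ j)))
                         (ones-cong _ _ p (λ i _ → cong F (sym (+-suc j i)))))
       (trans (sym (ones-+ g 1 p)) (cong (λ z → ones g p + bit z) (P j))))

countOnes : List Bool → ℕ
countOnes [] = 0
countOnes (x ∷ w) = bit x + countOnes w

countOnes-++ : ∀ u v → countOnes (u ++ v) ≡ countOnes u + countOnes v
countOnes-++ [] v = refl
countOnes-++ (x ∷ u) v = trans (cong (bit x +_) (countOnes-++ u v)) (sym (+-assoc (bit x) _ _))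

countOnes-pow : ∀ r w → countOnes (pow r w) ≡ r * countOnes w
countOnes-pow zero w = refl
countOnes-pow (suc r) w = trans (countOnes-++ w (pow r w)) (cong (countOnes w +_) (countOnes-pow r w))

ones-at : ∀ w → ones (at w) (length w) ≡ countOnes w
ones-at [] = refl
ones-at (x ∷ w) = trans (ones-+ (at (x ∷ w)) 1 (length w)) (cong (bit x +_) (ones-at w))

-- Two rotations of a period agree on their last letter as soon as they agree elsewhere:
-- both contain the same number of letters 1.
periodic-agree-last : ∀ {Q′} (F : Word) → Periodic (suc Q′) F → ∀ j j′ →
  (∀ i → i < Q′ → F (j + i) ≡ F (j′ + i)) → ∀ i → i < suc Q′ → F (j + i) ≡ F (j′ + i)
periodic-agree-last {Q′} F P j j′ agree i i<Q with m≤n⇒m<n∨m≡n (≤-pred i<Q)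
... | inj₁ i<Q′ = agree i i<Q′
... | inj₂ refl = bit-injective _ _ (+-cancelˡ-≡ (ones (λ i → F (j + i)) Q′) _ _ (begin
  ones (λ i → F (j + i)) (suc Q′)             ≡⟨ ones-rotate F P j ⟩
  ones F (suc Q′)                             ≡⟨ sym (ones-rotate F P j′) ⟩
  ones (λ i → F (j′ + i)) (suc Q′)            ≡⟨ cong (_+ bit (F (j′ + Q′)))
                                                  (sym (ones-cong _ _ Q′ agree)) ⟩
  ones (λ i → F (j + i)) Q′ + bit (F (j′ + Q′)) ∎))
  where open ≡-Reasoning

periodic-gcd : ∀ (F : Word) D Q → Periodic D F → Periodic Q F → ∃ λ g → GCD D Q g × Periodic g F
periodic-gcd F D Q PD PQ with Bézout.lemma D Q
... | Bézout.result g g-gcd (Bézout.+- x y eq) = g , g-gcd , λ t → begin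
  F (t + g)               ≡⟨ sym (periodic-* F PQ y (t + g)) ⟩
  F (t + g + y * Q)       ≡⟨ cong F (trans (+-assoc t g (y * Q)) (cong (t +_) eq)) ⟩
  F (t + x * D)           ≡⟨ periodic-* F PD x t ⟩
  F t                     ∎
  where open ≡-Reasoning
... | Bézout.result g g-gcd (Bézout.-+ x y eq) = g , g-gcd , λ t → begin
  F (t + g)               ≡⟨ sym (periodic-* F PD x (t + g)) ⟩
  F (t + g + x * D)       ≡⟨ cong F (trans (+-assoc t g (x * D)) (cong (t +_) eq)) ⟩
  F (t + y * Q)           ≡⟨ periodic-* F PQ y t ⟩
  F t                     ∎
  where open ≡-Reasoning

coprime-ones⇒divisor-period≡ : ∀ (F : Word) Q → (∀ k → k ∣ Q → k ∣ ones F Q → k ≡ 1) →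
  ∀ g → g ∣ Q → Periodic g F → g ≡ Q
coprime-ones⇒divisor-period≡ F Q coprime g (divides k Q≡kg) Pg =
  sym (trans Q≡kg (trans (cong (_* g) k≡1) (+-identityʳ g)))
  where
  k≡1 : k ≡ 1
  k≡1 = coprime k (divides g (trans Q≡kg (*-comm k g)))
    (divides (ones F g) (trans (cong (ones F) Q≡kg) (trans (ones-* F Pg k) (*-comm k _))))

-- Cycles of length Q in the Rauzy graph of a word that is Q-periodic on a long prefix

TurnsExactly : Word → ℕ → ℕ → ℕ → Set
TurnsExactly x m L D = Σ (Cycle x m) (λ C → len C ≡ L)
  × ((C : Cycle x m) → len C ≡ L → TurnsTimes x C D × ¬ TurnsTimes x C (suc D))

shifted-offset : ∀ k j p t → k + j * p + (j + t) ≡ k + t + j * suc p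
shifted-offset = solve-∀

module PeriodicPrefix
  (c ω e : Word) (Q′ m′ d′ : ℕ)
  (Q≤1+m : suc Q′ ≤ suc (suc m′))
  (ω-periodic : Periodic (suc Q′) ω)
  (c≡ω : ∀ t → t < suc d′ * suc Q′ + suc m′ → c t ≡ ω t)
  (ω-windows-distinct : ∀ j j′ → j < suc Q′ → j′ < suc Q′ →
     pre (suc m′) (λ i → ω (j + i)) ≡ pre (suc m′) (λ i → ω (j′ + i)) → j ≡ j′)
  (c-factors : ∀ p → (∃ λ k → ∀ i → i < suc Q′ → c (p + i) ≡ ω (k + i))
     ⊎ ((∀ i → i < suc Q′ → c (p + i) ≡ e i) × (∀ i → i < suc Q′ → c (suc p + i) ≡ ω i)))
  (c-breaks : ∃ λ t → t < suc m′ × (c (suc d′ * suc Q′ + t) ≢ c (suc d′ * suc Q′ + t + suc Q′)))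
  where

  Q m d : ℕ
  Q = suc Q′
  m = suc m′
  d = suc d′

  window : ℕ → List Bool
  window x = pre m (λ i → ω (x + i))

  window-periodic : ∀ x → window (x + Q) ≡ window x
  window-periodic x = pre-cong m _ _ (λ i _ → trans (cong ω (+-swapʳ x Q i)) (ω-periodic (x + i)))

  window-% : ∀ x y → window (x + y) ≡ window (x % Q + y)
  window-% x y = pre-cong m _ _ (λ i _ → trans (cong ω (+-assoc x y i))
    (trans (periodic-%ˡ ω ω-periodic x (y + i)) (cong ω (sym (+-assoc (x % Q) y i)))))

  window-%-self : ∀ x → window x ≡ window (x % Q)
  window-%-self x = trans (cong window (sym (+-identityʳ x)))
    (trans (window-% x 0) (cong window (+-identityʳ _)))

  window-≡-+ : ∀ x x′ → window x ≡ window x′ → ∀ r → window (x + r) ≡ window (x′ + r)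
  window-≡-+ x x′ eq r = trans (window-% x r) (trans (cong (λ z → window (z + r)) x≡x′)
    (sym (window-% x′ r)))
    where
    x≡x′ : x % Q ≡ x′ % Q
    x≡x′ = ω-windows-distinct (x % Q) (x′ % Q) (m%n<n x Q) (m%n<n x′ Q)
      (trans (sym (window-%-self x)) (trans eq (window-%-self x′)))

  module CycleOfLengthQ (C : Cycle c m) (len≡Q : len C ≡ Q) where

    vtx : ℕ → List Bool
    vtx = v C

    <Q⇒<len : ∀ {j} → j < Q → j < len C
    <Q⇒<len {j} p = subst (j <_) (sym len≡Q) p

    vtx-Q : vtx Q ≡ vtx 0
    vtx-Q = subst (λ L → vtx L ≡ vtx 0) len≡Q (closes C)

    arrow-occurrence : ∀ j → j < Q → ∃ λ i → (∀ t → t < m → at (vtx j) t ≡ c (i + t))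
                                            × (∀ t → t < m → at (vtx (suc j)) t ≡ c (i + suc t))
    arrow-occurrence j j<Q with arr C j (<Q⇒<len j<Q)
    ... | i , e₁ , e₂ = i , source , target
      where
      u = pre (suc m) (shift i c)
      source : ∀ t → t < m → at (vtx j) t ≡ c (i + t)
      source t t<m = trans (cong (λ l → at l t) (sym e₁))
        (trans (at-take m u t t<m) (at-pre (suc m) (shift i c) t (m≤n⇒m≤1+n t<m)))
      target : ∀ t → t < m → at (vtx (suc j)) t ≡ c (i + suc t)
      target t t<m = trans (cong (λ l → at l t) (sym e₂))
        (trans (at-drop-1 u t) (at-pre (suc m) (shift i c) (suc t) (s≤s t<m)))

    vertex-occurrence : ∀ j → j < Q → ∃ λ i → vtx j ≡ pre m (shift i c)
    vertex-occurrence j j<Q with vert C j (<Q⇒<len j<Q)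
    ... | i , e = i , sym e

    spelled : Word
    spelled t = at (vtx (t % Q)) 0

    spelled-periodic : Periodic Q spelled
    spelled-periodic t = cong (λ z → at (vtx z) 0) ([m+n]%n≡m%n t Q)

    mutual
      at-vtx : ∀ t → t < m → ∀ j → j < Q → at (vtx j) t ≡ spelled (j + t)
      at-vtx zero t<m j j<Q =
        cong (λ z → at (vtx z) 0) (sym (trans (cong (_% Q) (+-identityʳ j)) (m<n⇒m%n≡m j<Q)))
      at-vtx (suc t) t<m j j<Q with arrow-occurrence j j<Q
      ... | i , source , target = begin
        at (vtx j) (suc t)      ≡⟨ source (suc t) t<m ⟩
        c (i + suc t)           ≡⟨ sym (target t t<m′) ⟩
        at (vtx (suc j)) t      ≡⟨ at-vtx≤ t t<m′ (suc j) j<Q ⟩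
        spelled (suc j + t)     ≡⟨ cong spelled (sym (+-suc j t)) ⟩
        spelled (j + suc t)     ∎
        where
        open ≡-Reasoning
        t<m′ = <-trans (n<1+n t) t<m

      at-vtx≤ : ∀ t → t < m → ∀ j → j ≤ Q → at (vtx j) t ≡ spelled (j + t)
      at-vtx≤ t t<m j j≤Q with m≤n⇒m<n∨m≡n j≤Q
      ... | inj₁ j<Q = at-vtx t t<m j j<Q
      ... | inj₂ refl = trans (cong (λ l → at l t) vtx-Q) (trans (at-vtx t t<m 0 (s≤s z≤n))
                          (sym (trans (cong spelled (+-comm Q t)) (spelled-periodic t))))

    arrow-window : ∀ j → j < Q → ∃ λ i → ∀ t → t < suc m → c (i + t) ≡ spelled (j + t)
    arrow-window j j<Q with arrow-occurrence j j<Q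
    ... | i , source , target = i , g
      where
      g : ∀ t → t < suc m → c (i + t) ≡ spelled (j + t)
      g t t<1+m with m≤n⇒m<n∨m≡n (≤-pred t<1+m)
      ... | inj₁ t<m = trans (sym (source t t<m)) (at-vtx t t<m j j<Q)
      ... | inj₂ refl = trans (sym (target m′ (n<1+n m′)))
            (trans (at-vtx≤ m′ (n<1+n m′) (suc j) j<Q) (cong spelled (sym (+-suc j m′))))

    spelled-≡-shifted-ω : ∀ j i k → (∀ t → t < suc m → c (i + t) ≡ spelled (j + t)) →
      (∀ t → t < Q → c (i + t) ≡ ω (k + t)) → ∀ x → spelled x ≡ ω (k + j * Q′ + x)
    spelled-≡-shifted-ω j i k window-at-j ω-at-i =
      periodic-≡ spelled (λ x → ω (k + j * Q′ + x)) spelled-periodic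
        (periodic-shiftˡ ω ω-periodic (k + j * Q′)) j agree
      where
      agree : ∀ t → t < Q → spelled (j + t) ≡ ω (k + j * Q′ + (j + t))
      agree t t<Q = trans (sym (window-at-j t (≤-trans t<Q Q≤1+m)))
        (trans (ω-at-i t t<Q) (sym (trans (cong ω (shifted-offset k j Q′ t)) (periodic-* ω ω-periodic j (k + t)))))

    vtx-≡-pre-spelled : ∀ j → j < Q → vtx j ≡ pre m (λ t → spelled (j + t))
    vtx-≡-pre-spelled j j<Q with vertex-occurrence j j<Q
    ... | i , e = trans e (pre-cong m _ _ (λ t t<m →
                    trans (sym (at-≡pre m _ (vtx j) e t t<m)) (at-vtx t t<m j j<Q)))

    -- A constant spelled word would make the first two vertices equal.
    spelled-not-shift-invariant : 1 < Q → ¬ (∀ i → i < Q → spelled (suc i) ≡ spelled i)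
    spelled-not-shift-invariant 1<Q step = 0≢1+n (inj C 0 1 (<Q⇒<len (s≤s z≤n)) (<Q⇒<len 1<Q) vtx₀≡vtx₁)
      where
      from-0 : ∀ i → i < Q → spelled (0 + i) ≡ spelled 0
      from-0 zero _ = refl
      from-0 (suc i) i<Q = trans (step i (<-trans (n<1+n i) i<Q)) (from-0 i (<-trans (n<1+n i) i<Q))
      constant : ∀ x → spelled x ≡ spelled 0
      constant = periodic-≡ spelled (λ _ → spelled 0) spelled-periodic (λ _ → refl) 0 from-0
      vtx₀≡vtx₁ : vtx 0 ≡ vtx 1
      vtx₀≡vtx₁ = trans (vtx-≡-pre-spelled 0 (s≤s z≤n)) (trans
        (pre-cong m _ _ (λ t _ → trans (constant t) (sym (constant (1 + t)))))
        (sym (vtx-≡-pre-spelled 1 1<Q)))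

    spelled-is-shifted-ω : ∃ λ k → ∀ x → spelled x ≡ ω (k + x)
    spelled-is-shifted-ω with arrow-window 0 (s≤s z≤n)
    ... | i₀ , at-0 with c-factors i₀
    ... | inj₁ (k , ω-at) = k + 0 * Q′ , spelled-≡-shifted-ω 0 i₀ k at-0 ω-at
    ... | inj₂ (e-at , ω-after) with 1 <? Q
    ...   | no 1≮Q = 0 , periodic-≡ spelled (λ x → ω (0 + x)) spelled-periodic
                           (periodic-shiftˡ ω ω-periodic 0) 0 single-letter
      where
      Q≤1 : Q ≤ 1
      Q≤1 = ≮⇒≥ 1≮Q
      single-letter : ∀ i → i < Q → spelled (0 + i) ≡ ω (0 + i)
      single-letter zero _ = begin
        spelled 0         ≡⟨ sym (spelled-periodic 0) ⟩
        spelled Q         ≡⟨ cong spelled (≤-antisym Q≤1 (s≤s z≤n)) ⟩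
        spelled 1         ≡⟨ sym (at-0 1 (s≤s (s≤s z≤n))) ⟩
        c (i₀ + 1)        ≡⟨ cong c (trans (+-comm i₀ 1) (cong suc (sym (+-identityʳ i₀)))) ⟩
        c (suc i₀ + 0)    ≡⟨ ω-after 0 (s≤s z≤n) ⟩
        ω 0               ∎
        where open ≡-Reasoning
      single-letter (suc i) i<Q with ≤-trans i<Q Q≤1
      ... | s≤s ()
    ...   | yes 1<Q with arrow-window 1 1<Q
    ...     | i₁ , at-1 with c-factors i₁
    ...       | inj₁ (k , ω-at) = k + 1 * Q′ , spelled-≡-shifted-ω 1 i₁ k at-1 ω-at
    ...       | inj₂ (e-at′ , _) = ⊥-elim (spelled-not-shift-invariant 1<Q (λ i i<Q →
                 let i<1+m = ≤-trans i<Q Q≤1+m in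
                 trans (sym (at-1 i i<1+m)) (trans (e-at′ i i<Q)
                   (trans (sym (e-at i i<Q)) (at-0 i i<1+m)))))

    vertices-are-windows : ∃ λ k → k < Q × ∀ j → j ≤ Q → vtx j ≡ window (k + j)
    vertices-are-windows with spelled-is-shifted-ω
    ... | k , spelled≡ = k % Q , m%n<n k Q , λ j j≤Q → trans (vtx≡window j j≤Q) (window-% k j)
      where
      vtx≡window< : ∀ j → j < Q → vtx j ≡ window (k + j)
      vtx≡window< j j<Q = trans (vtx-≡-pre-spelled j j<Q) (pre-cong m _ _ (λ t _ →
        trans (spelled≡ (j + t)) (cong ω (sym (+-assoc k j t)))))
      vtx≡window : ∀ j → j ≤ Q → vtx j ≡ window (k + j)
      vtx≡window j j≤Q with m≤n⇒m<n∨m≡n j≤Q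
      ... | inj₁ j<Q = vtx≡window< j j<Q
      ... | inj₂ refl = trans vtx-Q (trans (vtx≡window< 0 (s≤s z≤n))
                          (trans (cong window (+-identityʳ k)) (sym (window-periodic k))))

  ≡mod : ℕ → ℕ → Set
  ≡mod x y = x ≡ y ⊎ x ≡ y + Q

  ≡mod-suc : ∀ {x y} → ≡mod x y → ≡mod (suc x) (suc y)
  ≡mod-suc (inj₁ refl) = inj₁ refl
  ≡mod-suc (inj₂ refl) = inj₂ refl

  window-≡mod : ∀ {x y} → ≡mod x y → window x ≡ window y
  window-≡mod (inj₁ refl) = refl
  window-≡mod {y = y} (inj₂ refl) = window-periodic y

  ≡mod-+-suc : ∀ k j′ {j} → ≡mod (k + j′) j → ≡mod (k + suc j′) (suc j)
  ≡mod-+-suc k j′ {j} eq = subst (λ z → ≡mod z (suc j)) (sym (+-suc k j′)) (≡mod-suc eq)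

  subtract-mod : ∀ k j → k < Q → j < Q → ∃ λ j′ → j′ < Q × ≡mod (k + j′) j
  subtract-mod k j k<Q j<Q with k ≤? j
  ... | yes k≤j = j ∸ k , ≤-<-trans (m∸n≤m j k) j<Q , inj₁ (m+[n∸m]≡n k≤j)
  ... | no k≰j = j + Q ∸ k , m<n+o⇒m∸n<o (j + Q) k (+-monoˡ-< Q (≰⇒> k≰j)) ,
                 inj₂ (m+[n∸m]≡n (≤-trans (<⇒≤ k<Q) (m≤n+m Q j)))

  add-mod : ∀ k j′ → k < Q → j′ < Q → ∃ λ j → j < Q × ≡mod (k + j′) j
  add-mod k j′ k<Q j′<Q with k + j′ <? Q
  ... | yes k+j′<Q = k + j′ , k+j′<Q , inj₁ refl
  ... | no k+j′≮Q = k + j′ ∸ Q , m<n+o⇒m∸n<o (k + j′) Q (+-mono-< k<Q j′<Q) ,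
                    inj₂ (sym (m∸n+n≡m (≮⇒≥ k+j′≮Q)))

  path-windows : ∀ i → i < d → ∀ j → j ≤ Q → pre m (shift j (shift (i * Q) c)) ≡ window j
  path-windows i i<d j j≤Q = pre-cong m _ _ agree
    where
    agree : ∀ t → t < m → c (i * Q + (j + t)) ≡ ω (j + t)
    agree t t<m = trans (c≡ω _ bound)
      (trans (cong ω (+-comm (i * Q) (j + t))) (periodic-* ω ω-periodic i (j + t)))
      where
      bound : i * Q + (j + t) < d * Q + m
      bound = subst (i * Q + (j + t) <_) (trans (+-swapˡ (d′ * Q) Q m) (sym (+-assoc Q (d′ * Q) m)))
        (+-mono-≤-< (*-monoˡ-≤ Q (≤-pred i<d)) (+-mono-≤-< j≤Q t<m))

  windowCycle : Cycle c m
  windowCycle = record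
    { len = Q ; len≥1 = s≤s z≤n ; v = window
    ; vert = λ j j<Q → j , path-windows 0 (s≤s z≤n) j (<⇒≤ j<Q)
    ; inj = λ i j i<Q j<Q e → ω-windows-distinct i j i<Q j<Q e
    ; arr = λ j j<Q → j , trans (take-pre m (shift j c)) (path-windows 0 (s≤s z≤n) j (<⇒≤ j<Q))
                        , trans (drop-pre m (shift j c))
                            (trans (pre-cong m _ _ (λ t _ → cong c (+-suc j t)))
                              (path-windows 0 (s≤s z≤n) (suc j) j<Q))
    ; closes = window-periodic 0 }

  turns : ∀ (C : Cycle c m) → len C ≡ Q → ∀ i → i < d → TurnsAround (shift (i * Q) c) C
  turns C len≡Q i i<d = subst (RepIs y m) (sym len≡Q) repetition , path⊆cycle , cycle⊆path
    where
    open CycleOfLengthQ C len≡Q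
    y = shift (i * Q) c
    y-windows : ∀ j → j ≤ Q → pre m (shift j y) ≡ window j
    y-windows = path-windows i i<d
    repetition : RepIs y m Q
    repetition = s≤s z≤n , distinct , maximal
      where
      distinct : DistinctPrefixes y m Q
      distinct j j′ j<Q j′<Q eq = ω-windows-distinct j j′ j<Q j′<Q
        (trans (sym (y-windows j (<⇒≤ j<Q))) (trans eq (y-windows j′ (<⇒≤ j′<Q))))
      maximal : ∀ k → DistinctPrefixes y m k → k ≤ Q
      maximal k D with k ≤? Q
      ... | yes k≤Q = k≤Q
      ... | no k≰Q = ⊥-elim (0≢1+n (D 0 Q (≤-<-trans z≤n (≰⇒> k≰Q)) (≰⇒> k≰Q)
                      (trans (y-windows 0 z≤n) (trans (sym (window-periodic 0)) (sym (y-windows Q ≤-refl))))))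
    k = proj₁ vertices-are-windows
    k<Q = proj₁ (proj₂ vertices-are-windows)
    vtx≡window = proj₂ (proj₂ vertices-are-windows)
    path⊆cycle : ∀ s t → InPath y m (len C) s t → InCycle C s t
    path⊆cycle s t (j , j<len , s≡ , t≡) with subtract-mod k j k<Q j<Q
      where j<Q = subst (j <_) len≡Q j<len
    ... | j′ , j′<Q , eq = j′ , <Q⇒<len j′<Q ,
          trans s≡ (trans (y-windows j (<⇒≤ j<Q))
            (sym (trans (vtx≡window j′ (<⇒≤ j′<Q)) (window-≡mod eq)))) ,
          trans t≡ (trans (y-windows (suc j) j<Q)
            (sym (trans (vtx≡window (suc j′) j′<Q) (window-≡mod (≡mod-+-suc k j′ eq)))))
      where j<Q = subst (j <_) len≡Q j<len
    cycle⊆path : ∀ s t → InCycle C s t → InPath y m (len C) s t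
    cycle⊆path s t (j′ , j′<len , s≡ , t≡) with add-mod k j′ k<Q j′<Q
      where j′<Q = subst (j′ <_) len≡Q j′<len
    ... | j , j<Q , eq = j , <Q⇒<len j<Q ,
          trans s≡ (trans (vtx≡window j′ (<⇒≤ j′<Q))
            (trans (window-≡mod eq) (sym (y-windows j (<⇒≤ j<Q))))) ,
          trans t≡ (trans (vtx≡window (suc j′) j′<Q)
            (trans (window-≡mod (≡mod-+-suc k j′ eq)) (sym (y-windows (suc j) j<Q))))
      where j′<Q = subst (j′ <_) len≡Q j′<len

  -- Along a turn, consecutive prefixes are consecutive windows of ω, so c would be
  -- Q-periodic on [dQ, dQ + Q + m), against c-breaks.
  does-not-turn : ∀ (C : Cycle c m) → len C ≡ Q → ¬ TurnsAround (shift (d * Q) c) C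
  does-not-turn C len≡Q (_ , path⊆cycle , _) = c-breaks-at (trans c-at-t (sym c-at-t+Q))
    where
    open CycleOfLengthQ C len≡Q
    y = shift (d * Q) c
    prefix : ℕ → List Bool
    prefix j = pre m (shift j y)
    k = proj₁ vertices-are-windows
    vtx≡window = proj₂ (proj₂ vertices-are-windows)
    step : ∀ j → j < Q → ∃ λ s → (prefix j ≡ window (k + s)) × (prefix (suc j) ≡ window (k + suc s))
    step j j<Q with path⊆cycle (prefix j) (prefix (suc j)) (j , <Q⇒<len j<Q , refl , refl)
    ... | s , s<len , e₁ , e₂ = s , trans e₁ (vtx≡window s (<⇒≤ s<Q)) , trans e₂ (vtx≡window (suc s) s<Q)
      where s<Q = subst (s <_) len≡Q s<len
    K = k + proj₁ (step 0 (s≤s z≤n))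
    prefix≡window : ∀ j → j ≤ Q → prefix j ≡ window (K + j)
    prefix≡window zero _ = trans (proj₁ (proj₂ (step 0 (s≤s z≤n)))) (cong window (sym (+-identityʳ K)))
    prefix≡window (suc j) j<Q with step j j<Q
    ... | s , e₁ , e₂ = begin
      prefix (suc j)          ≡⟨ e₂ ⟩
      window (k + suc s)      ≡⟨ cong window (+-suc k s) ⟩
      window (suc (k + s))    ≡⟨ cong window (+-comm 1 (k + s)) ⟩
      window (k + s + 1)      ≡⟨ sym (window-≡-+ (K + j) (k + s) (trans (sym (prefix≡window j (<⇒≤ j<Q))) e₁) 1) ⟩
      window (K + j + 1)      ≡⟨ cong window (trans (+-assoc K j 1) (cong (K +_) (+-comm j 1))) ⟩
      window (K + suc j)      ∎
      where open ≡-Reasoning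
    t = proj₁ c-breaks
    t<m = proj₁ (proj₂ c-breaks)
    c-breaks-at = proj₂ (proj₂ c-breaks)
    c-at-t : c (d * Q + t) ≡ ω (K + t)
    c-at-t = trans (pre-≡⇒≡ m _ _ (prefix≡window 0 z≤n) t t<m) (cong ω (cong (_+ t) (+-identityʳ K)))
    c-at-t+Q : c (d * Q + t + Q) ≡ ω (K + t)
    c-at-t+Q = trans (cong c (trans (+-assoc (d * Q) t Q) (cong (d * Q +_) (+-comm t Q))))
      (trans (pre-≡⇒≡ m _ _ (prefix≡window Q ≤-refl) t t<m)
        (trans (cong ω (+-swapʳ K Q t)) (ω-periodic (K + t))))

  turns-exactly : ∀ L D → L ≡ Q → D ≡ d → TurnsExactly c m L D
  turns-exactly L D refl refl = (windowCycle , refl) , λ C len≡Q →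
    (λ i i<d → subst (λ z → TurnsAround (shift (i * z) c) C) (sym len≡Q) (turns C len≡Q i i<d)) ,
    (λ T → does-not-turn C len≡Q (subst (λ z → TurnsAround (shift (d * z) c) C) len≡Q (T d (n<1+n d))))

-- Standard words

length-pow : ∀ r (w : List Bool) → length (pow r w) ≡ r * length w
length-pow zero w = refl
length-pow (suc r) w = trans (length-++ w) (cong (length w +_) (length-pow r w))

pow-comm : ∀ r (w : List Bool) → w ++ pow r w ≡ pow r w ++ w
pow-comm zero w = ++-identityʳ w
pow-comm (suc r) w = trans (cong (w ++_) (pow-comm r w)) (sym (++-assoc w (pow r w) w))

at-pow-suc : ∀ r (X z : List Bool) t → t < length X → at (pow (suc r) X ++ z) t ≡ at X t
at-pow-suc r X z t p = trans (cong (λ l → at l t) (++-assoc X (pow r X) z)) (at-++ˡ X _ t p)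

zeros : ℕ → List Bool
zeros b = pow b (false ∷ [])

at-zeros : ∀ b z t → t < b → at (zeros b ++ z) t ≡ false
at-zeros (suc b) z zero p = refl
at-zeros (suc b) z (suc t) (s≤s p) = at-zeros b z t p

at-zeros-+ : ∀ b z t → at (zeros b ++ z) (b + t) ≡ at z t
at-zeros-+ zero z t = refl
at-zeros-+ (suc b) z t = at-zeros-+ b z t

DifferLastTwo : List Bool → List Bool → ℕ → Set
DifferLastTwo X Y Λ = (∀ t → suc (suc t) < Λ → at X t ≡ at Y t)
  × (∀ t → suc (suc t) ≡ Λ → at X t ≢ at Y t)
  × (∀ t → suc t ≡ Λ → at X t ≢ at Y t)

DifferLastTwo-sym : ∀ {X Y Λ} → DifferLastTwo X Y Λ → DifferLastTwo Y X Λ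
DifferLastTwo-sym (same , last₂ , last₁) =
  (λ t p → sym (same t p)) , (λ t p e → last₂ t p (sym e)) , (λ t p e → last₁ t p (sym e))

DifferLastTwo-++ˡ : ∀ {X Y Λ} (P : List Bool) → 2 ≤ Λ → DifferLastTwo X Y Λ →
                    DifferLastTwo (P ++ X) (P ++ Y) (length P + Λ)
DifferLastTwo-++ˡ {X} {Y} {Λ} P 2≤Λ (same , last₂ , last₁) = same′ , last₂′ , last₁′
  where
  same′ : ∀ t → suc (suc t) < length P + Λ → at (P ++ X) t ≡ at (P ++ Y) t
  same′ t p with <⊎offset (length P) t
  ... | inj₁ lt = trans (at-++ˡ P X t lt) (sym (at-++ˡ P Y t lt))
  ... | inj₂ (t′ , refl) = trans (at-++ʳ P X t′) (trans (same t′ (+-cancelˡ-< (length P) _ _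
                             (subst (_< length P + Λ) (sym (+-suc-suc (length P) t′)) p)))
                             (sym (at-++ʳ P Y t′)))
  last₂′ : ∀ t → suc (suc t) ≡ length P + Λ → at (P ++ X) t ≢ at (P ++ Y) t
  last₂′ t p with <⊎offset (length P) t
  ... | inj₁ lt = ⊥-elim (<-irrefl p (≤-trans (s≤s (s≤s lt))
                    (≤-trans (≤-reflexive (+-comm 2 (length P))) (+-monoʳ-≤ (length P) 2≤Λ))))
  ... | inj₂ (t′ , refl) = λ e → last₂ t′ (+-cancelˡ-≡ (length P) _ _ (trans (+-suc-suc (length P) t′) p))
                             (trans (sym (at-++ʳ P X t′)) (trans e (at-++ʳ P Y t′)))
  last₁′ : ∀ t → suc t ≡ length P + Λ → at (P ++ X) t ≢ at (P ++ Y) t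
  last₁′ t p with <⊎offset (length P) t
  ... | inj₁ lt = ⊥-elim (<-irrefl p (≤-trans (s≤s lt)
                    (≤-trans (≤-reflexive (+-comm 1 (length P))) (+-monoʳ-≤ (length P) (≤-trans (s≤s z≤n) 2≤Λ)))))
  ... | inj₂ (t′ , refl) = λ e → last₁ t′ (+-cancelˡ-≡ (length P) _ _ (trans (+-suc (length P) t′) p))
                             (trans (sym (at-++ʳ P X t′)) (trans e (at-++ʳ P Y t′)))

DifferLastTwo-zeros : ∀ b → DifferLastTwo (zeros b ++ (true ∷ false ∷ [])) (zeros (suc b) ++ (true ∷ [])) (suc (suc b))
DifferLastTwo-zeros b = same , last₂ , last₁
  where
  X = zeros b ++ (true ∷ false ∷ [])
  Y = zeros (suc b) ++ (true ∷ [])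
  same : ∀ t → suc (suc t) < suc (suc b) → at X t ≡ at Y t
  same t (s≤s (s≤s t<b)) = trans (at-zeros b _ t t<b) (sym (at-zeros (suc b) _ t (<-trans t<b (n<1+n b))))
  last₂ : ∀ t → suc (suc t) ≡ suc (suc b) → at X t ≢ at Y t
  last₂ t refl e with trans (sym (subst (λ i → at X i ≡ true) (+-identityʳ t) (at-zeros-+ t _ 0))) e
  ... | 1≡0 with trans 1≡0 (at-zeros (suc t) (true ∷ []) t (n<1+n t))
  ... | ()
  last₁ : ∀ t → suc t ≡ suc (suc b) → at X t ≢ at Y t
  last₁ .(suc b) refl e with trans (sym (subst (λ i → at X i ≡ false) (+-comm b 1) (at-zeros-+ b _ 1))) e
  ... | 0≡1 with trans 0≡1 (subst (λ i → at Y i ≡ true) (+-identityʳ (suc b)) (at-zeros-+ (suc b) _ 0))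
  ... | ()

OccursAt : List Bool → ℕ → List Bool → Set
OccursAt w b u = (b + length u ≤ length w) × (∀ i → i < length u → at w (b + i) ≡ at u i)

occursAt-self : ∀ u → OccursAt u 0 u
occursAt-self u = ≤-refl , λ i _ → refl

occursAt-++ : ∀ w z b u → OccursAt w b u → OccursAt (w ++ z) b u
occursAt-++ w z b u (fits , h) =
  ≤-trans fits (≤-trans (m≤m+n (length w) (length z)) (≤-reflexive (sym (length-++ w)))) ,
  λ i i<u → trans (at-++ˡ w z (b + i) (<-≤-trans (+-monoʳ-< b i<u) fits)) (h i i<u)

occursAt-++ˡ : ∀ P w b u → OccursAt w b u → OccursAt (P ++ w) (length P + b) u
occursAt-++ˡ P w b u (fits , h) =
  ≤-trans (≤-reflexive (+-assoc (length P) b (length u)))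
    (≤-trans (+-monoʳ-≤ (length P) fits) (≤-reflexive (sym (length-++ P)))) ,
  λ i i<u → trans (cong (at (P ++ w)) (+-assoc (length P) b i)) (trans (at-++ʳ P w (b + i)) (h i i<u))

occursAt-++-prefix : ∀ u z v → OccursAt z 0 v → OccursAt (u ++ z) 0 (u ++ v)
occursAt-++-prefix u z v (fits , h) =
  ≤-trans (≤-reflexive (length-++ u)) (≤-trans (+-monoʳ-≤ (length u) fits) (≤-reflexive (sym (length-++ u)))) ,
  g
  where
  g : ∀ i → i < length (u ++ v) → at (u ++ z) (0 + i) ≡ at (u ++ v) i
  g i i<uv with <⊎offset (length u) i
  ... | inj₁ lt = trans (at-++ˡ u z i lt) (sym (at-++ˡ u v i lt))
  ... | inj₂ (i′ , refl) = trans (at-++ʳ u z i′)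
        (trans (h i′ (+-cancelˡ-< (length u) _ _ (subst (length u + i′ <_) (length-++ u) i<uv)))
          (sym (at-++ʳ u v i′)))

occursAt-pow : ∀ X Y u r → OccursAt X 0 u → 1 ≤ r → OccursAt (pow r X ++ Y) 0 u
occursAt-pow X Y u (suc r) o _ = occursAt-++ (X ++ pow r X) Y 0 u (occursAt-++ X (pow r X) 0 u o)

det-step₁ : ∀ (A P₁ P₀ Q₁ : ℕ) → (A * P₁ + P₀) * Q₁ ≡ A * P₁ * Q₁ + Q₁ * P₀
det-step₁ = solve-∀

det-step₂ : ∀ (A P₁ Q₁ Q₀ : ℕ) → (A * Q₁ + Q₀) * P₁ ≡ A * P₁ * Q₁ + P₁ * Q₀
det-step₂ = solve-∀

block-length : ∀ (d l Q QM : ℕ) → d * Q + (suc l * Q + QM) ≡ (d + l) * Q + (Q + QM)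
block-length = solve-∀

module StandardWords (a : ℕ → ℕ) (slope : IsSlope a) where

  s : ℕ → List Bool
  s = sw a

  c : Word
  c = charWord a

  length-sw : ∀ k → length (s k) ≡ q a k
  length-sw zero = refl
  length-sw (suc zero) = trans (length-++ (pow (a 1 ∸ 1) (false ∷ [])))
    (trans (cong (_+ 1) (length-pow (a 1 ∸ 1) (false ∷ [])))
    (trans (cong (_+ 1) (*-identityʳ (a 1 ∸ 1))) (trans (m∸n+n≡m (slope 0))
    (sym (trans (+-identityʳ (a 1 * 1)) (*-identityʳ (a 1)))))))
  length-sw (suc (suc k)) = trans (length-++ (pow (a (suc (suc k))) (s (suc k))))
    (trans (cong (_+ length (s k)) (length-pow (a (suc (suc k))) (s (suc k))))
    (cong₂ _+_ (cong (a (suc (suc k)) *_) (length-sw (suc k))) (length-sw k)))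

  ≤a* : ∀ k x → x ≤ a (suc k) * x
  ≤a* k x with a (suc k) | slope k
  ... | suc b | _ = m≤m+n x (b * x)

  q-positive : ∀ k → 1 ≤ q a k
  q-positive zero = s≤s z≤n
  q-positive (suc zero) = ≤-trans (slope 0) (≤-trans (≤-reflexive (sym (*-identityʳ (a 1)))) (m≤m+n (a 1 * 1) 0))
  q-positive (suc (suc k)) = ≤-trans (q-positive k) (m≤n+m (q a k) _)

  q-≤-suc : ∀ k → q a k ≤ q a (suc k)
  q-≤-suc zero = q-positive 1
  q-≤-suc (suc k) = ≤-trans (≤a* (suc k) (q a (suc k))) (m≤m+n _ (q a k))

  q-mono : ∀ k d → q a k ≤ q a (d + k)
  q-mono k zero = ≤-refl
  q-mono k (suc d) = ≤-trans (q-mono k d) (q-≤-suc (d + k))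

  n≤q : ∀ k → k ≤ q a k
  n≤q zero = z≤n
  n≤q (suc zero) = q-positive 1
  n≤q (suc (suc k)) = ≤-trans (s≤s (n≤q (suc k))) (≤-trans (≤-reflexive (+-comm 1 (q a (suc k))))
                        (+-mono-≤ (≤a* (suc k) (q a (suc k))) (q-positive k)))

  at-sw-suc : ∀ k t → t < q a (suc k) → at (s (suc (suc k))) t ≡ at (s (suc k)) t
  at-sw-suc k t p with a (suc (suc k)) | slope (suc k)
  ... | suc b | _ = at-pow-suc b (s (suc k)) (s k) t (subst (t <_) (sym (length-sw (suc k))) p)

  at-sw-+ : ∀ K d t → t < q a (suc K) → at (s (suc (d + K))) t ≡ at (s (suc K)) t
  at-sw-+ K zero t p = refl
  at-sw-+ K (suc d) t p = trans (at-sw-suc (d + K) t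
    (≤-trans p (subst (λ z → q a (suc K) ≤ q a z) (+-suc d K) (q-mono (suc K) d)))) (at-sw-+ K d t p)

  c≡sw : ∀ K t → t < q a (suc K) → c t ≡ at (s (suc K)) t
  c≡sw K t p = trans (sym (at-sw-+ (suc t) K t t<q))
    (trans (cong (λ z → at (s (suc z)) t) (+-comm K (suc t))) (at-sw-+ K (suc t) t p))
    where
    t<q : t < q a (suc (suc t))
    t<q = ≤-trans (n≤1+n (suc t)) (n≤q (suc (suc t)))

  -- pp k = p_{k-1}, the numerators, shifted like qq; p_n counts the letters 1 of s_n.
  pp : ℕ → ℕ
  pp zero = 1
  pp (suc zero) = 0
  pp (suc (suc k)) = a (suc k) * pp (suc k) + pp k

  countOnes-sw : ∀ k → countOnes (s k) ≡ pp (suc k)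
  countOnes-sw zero = refl
  countOnes-sw (suc zero) = trans (countOnes-++ (pow (a 1 ∸ 1) (false ∷ [])) (true ∷ []))
    (cong (_+ 1) (trans (countOnes-pow (a 1 ∸ 1) (false ∷ [])) (trans (*-zeroʳ (a 1 ∸ 1)) (sym (*-zeroʳ (a 1))))))
  countOnes-sw (suc (suc k)) = trans (countOnes-++ (pow (a (suc (suc k))) (s (suc k))) (s k))
    (cong₂ _+_ (trans (countOnes-pow (a (suc (suc k))) (s (suc k))) (cong (a (suc (suc k)) *_) (countOnes-sw (suc k))))
               (countOnes-sw k))

  determinant : ∀ k → qq a (suc k) * pp k ≡ suc (pp (suc k) * qq a k)
                    ⊎ pp (suc k) * qq a k ≡ suc (qq a (suc k) * pp k)
  determinant zero = inj₁ refl
  determinant (suc k) with determinant k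
  ... | inj₁ h = inj₂ (trans (det-step₁ A P₁ P₀ Q₁) (trans (cong (A * P₁ * Q₁ +_) h)
                   (trans (+-suc (A * P₁ * Q₁) (P₁ * Q₀)) (cong suc (sym (det-step₂ A P₁ Q₁ Q₀))))))
    where
    A = a (suc k)
    P₁ = pp (suc k)
    P₀ = pp k
    Q₁ = qq a (suc k)
    Q₀ = qq a k
  ... | inj₂ h = inj₁ (trans (det-step₂ A P₁ Q₁ Q₀) (trans (cong (A * P₁ * Q₁ +_) h)
                   (trans (+-suc (A * P₁ * Q₁) (Q₁ * P₀)) (cong suc (sym (det-step₁ A P₁ P₀ Q₁))))))
    where
    A = a (suc k)
    P₁ = pp (suc k)
    P₀ = pp k
    Q₁ = qq a (suc k)
    Q₀ = qq a k

  qq-pp-coprime : ∀ k g → g ∣ qq a (suc k) → g ∣ pp (suc k) → g ≡ 1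
  qq-pp-coprime k g g∣q g∣p with determinant k
  ... | inj₁ e = ∣1⇒≡1 (∣m+n∣m⇒∣n (subst (g ∣_) (trans e (+-comm 1 _)) (∣m⇒∣m*n (pp k) g∣q))
                                  (∣m⇒∣m*n (qq a k) g∣p))
  ... | inj₂ e = ∣1⇒≡1 (∣m+n∣m⇒∣n (subst (g ∣_) (trans e (+-comm 1 _)) (∣m⇒∣m*n (qq a k) g∣p))
                                  (∣m⇒∣m*n (pp k) g∣q))

  -- By induction: s_{k+2} s_{k+1} = P s_k s_{k+1} and s_{k+1} s_{k+2} = P s_{k+1} s_k with P = s_{k+1}^{a_{k+2}}.
  sw-swap : ∀ k → DifferLastTwo (s (suc k) ++ s k) (s k ++ s (suc k)) (length (s (suc k) ++ s k))
  sw-swap zero = subst₂ (λ X Λ → DifferLastTwo X (s 0 ++ s 1) Λ)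
    (sym (++-assoc (zeros (a 1 ∸ 1)) (true ∷ []) (false ∷ []))) (sym length-s₁s₀) (DifferLastTwo-zeros (a 1 ∸ 1))
    where
    length-s₁s₀ : length (s 1 ++ s 0) ≡ suc (suc (a 1 ∸ 1))
    length-s₁s₀ = trans (length-++ (s 1)) (trans (cong (_+ 1) (length-sw 1)) (trans (+-comm _ 1) (cong suc
      (trans (+-identityʳ (a 1 * 1)) (trans (*-identityʳ (a 1)) (sym (trans (+-comm 1 (a 1 ∸ 1)) (m∸n+n≡m (slope 0)))))))))
  sw-swap (suc k) = subst₂ (λ X Λ → DifferLastTwo X (N ++ (P ++ M)) Λ) (sym (++-assoc P M N)) lengths
    (subst (λ Y → DifferLastTwo (P ++ (M ++ N)) Y (length P + length (N ++ M))) Y≡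
      (DifferLastTwo-++ˡ {X = M ++ N} {Y = N ++ M} P 2≤|NM| (DifferLastTwo-sym {X = N ++ M} {Y = M ++ N} (sw-swap k))))
    where
    N = s (suc k)
    M = s k
    P = pow (a (suc (suc k))) N
    Y≡ : P ++ (N ++ M) ≡ N ++ (P ++ M)
    Y≡ = trans (sym (++-assoc P N M)) (trans (cong (_++ M) (sym (pow-comm (a (suc (suc k))) N))) (++-assoc N P M))
    lengths : length P + length (N ++ M) ≡ length ((P ++ M) ++ N)
    lengths = trans (cong (length P +_) (trans (length-++ N) (trans (+-comm (length N) (length M)) (sym (length-++ M)))))
                (trans (sym (length-++ P)) (cong length (sym (++-assoc P M N))))
    2≤|NM| : 2 ≤ length (N ++ M)
    2≤|NM| = ≤-trans (+-mono-≤ (≤-trans (q-positive (suc k)) (≤-reflexive (sym (length-sw (suc k)))))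
                               (≤-trans (q-positive k) (≤-reflexive (sym (length-sw k)))))
                     (≤-reflexive (sym (length-++ N)))

  -- Every position of c_α lies in the first q_{n+1} letters of an occurrence of
  -- s_{n+1} s_{n+1} or s_{n+1} s_n s_{n+1}, or in the first q_n letters of one of s_n s_{n+1}.
  module Blocks (n : ℕ) where

    N M : List Bool
    N = s (suc n)
    M = s n

    QN QM : ℕ
    QN = length N
    QM = length M

    data Block : Set where
      NN NMN MN : Block

    block : Block → List Bool
    block NN = N ++ N
    block NMN = N ++ (M ++ N)
    block MN = M ++ N

    reach : Block → ℕ
    reach NN = QN
    reach NMN = QN
    reach MN = QM

    CoveredBy : (ℕ → List Bool → Set) → ℕ → Set
    CoveredBy occurs p = ∃ λ b → Σ Block λ β → b ≤ p × p < b + reach β × occurs b (block β)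

    Covered : List Bool → ℕ → Set
    Covered w = CoveredBy (OccursAt w)

    covered-++ˡ : ∀ P w p → Covered w p → Covered (P ++ w) (length P + p)
    covered-++ˡ P w p (b , β , b≤p , p<b+r , o) =
      length P + b , β , +-monoʳ-≤ (length P) b≤p ,
      subst (length P + p <_) (sym (+-assoc (length P) b (reach β))) (+-monoʳ-< (length P) p<b+r) ,
      occursAt-++ˡ P w b (block β) o

    <length-++⇒ : ∀ (P w : List Bool) p′ → length P + p′ < length (P ++ w) → p′ < length w
    <length-++⇒ P w p′ p< = +-cancelˡ-< (length P) _ _ (subst (length P + p′ <_) (length-++ P) p<)

    sw-starts-with : ∀ j → OccursAt (s (j + suc n)) 0 N
    sw-starts-with zero = occursAt-self N
    sw-starts-with (suc j) = subst (λ k → OccursAt (s (suc k)) 0 N) (sym (+-suc j n))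
      (occursAt-pow (s (suc (j + n))) (s (j + n)) N (a (suc (suc (j + n))))
        (subst (λ k → OccursAt (s k) 0 N) (+-suc j n) (sw-starts-with j)) (slope (suc (j + n))))

    pow-++-starts-with : ∀ r X y u → OccursAt X 0 u → OccursAt y 0 u → OccursAt (pow r X ++ y) 0 u
    pow-++-starts-with zero X y u oX oy = oy
    pow-++-starts-with (suc r) X y u oX oy = occursAt-pow X y u (suc r) oX (s≤s z≤n)

    pow-++-starts-with-block : ∀ r X Y → 1 ≤ r → OccursAt X 0 N → OccursAt Y 0 N → OccursAt (pow r X ++ Y) 0 (X ++ N)
    pow-++-starts-with-block (suc r) X Y _ oX oY = subst (λ v → OccursAt v 0 (X ++ N)) (sym (++-assoc X (pow r X) Y))
      (occursAt-++-prefix X _ N (pow-++-starts-with r X Y N oX oY))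

    covered-pow : ∀ r y → (OccursAt y 0 N ⊎ OccursAt y 0 (M ++ N)) →
                  ∀ p → p < length (pow r N) → Covered (pow r N ++ y) p
    covered-pow (suc r) y y-starts p p< = subst (λ w → Covered w p) (sym (++-assoc N (pow r N) y)) covered
      where
      next : ∀ r → OccursAt (pow r N ++ y) 0 N ⊎ OccursAt (pow r N ++ y) 0 (M ++ N)
      next zero = y-starts
      next (suc r′) = inj₁ (occursAt-pow N y N (suc r′) (occursAt-self N) (s≤s z≤n))
      covered : Covered (N ++ (pow r N ++ y)) p
      covered with <⊎offset QN p | next r
      ... | inj₁ p<N | inj₁ o = 0 , NN , z≤n , p<N , occursAt-++-prefix N _ N o
      ... | inj₁ p<N | inj₂ o = 0 , NMN , z≤n , p<N , occursAt-++-prefix N _ (M ++ N) o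
      ... | inj₂ (p′ , refl) | _ =
            covered-++ˡ N _ p′ (covered-pow r y y-starts p′ (<length-++⇒ N (pow r N) p′ p<))

    covered-pow-block : ∀ r B → (∀ z → OccursAt z 0 N → ∀ p → p < length B → Covered (B ++ z) p) →
                        OccursAt B 0 N → ∀ z → OccursAt z 0 N → ∀ p → p < length (pow r B) → Covered (pow r B ++ z) p
    covered-pow-block (suc r) B B-covered B-starts z z-starts p p< =
      subst (λ w → Covered w p) (sym (++-assoc B (pow r B) z)) covered
      where
      covered : Covered (B ++ (pow r B ++ z)) p
      covered with <⊎offset (length B) p
      ... | inj₁ p<B = B-covered (pow r B ++ z) (pow-++-starts-with r B z N B-starts z-starts) p p<B
      ... | inj₂ (p′ , refl) = covered-++ˡ B _ p′
            (covered-pow-block r B B-covered B-starts z z-starts p′ (<length-++⇒ B (pow r B) p′ p<))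

    CoveredSw : ℕ → Set
    CoveredSw j = ∀ z → OccursAt z 0 N → ∀ p → p < length (s (j + suc n)) → Covered (s (j + suc n) ++ z) p

    covered-sw-1 : CoveredSw 1
    covered-sw-1 z z-starts p p< = subst (λ w → Covered w p) (sym (++-assoc P M z)) covered
      where
      P = pow (a (suc (suc n))) N
      Mz-starts : OccursAt (M ++ z) 0 (M ++ N)
      Mz-starts = occursAt-++-prefix M z N z-starts
      covered : Covered (P ++ (M ++ z)) p
      covered with <⊎offset (length P) p
      ... | inj₁ p<P = covered-pow (a (suc (suc n))) (M ++ z) (inj₂ Mz-starts) p p<P
      ... | inj₂ (p′ , refl) = length P , MN , m≤m+n (length P) p′ ,
            +-monoʳ-< (length P) (<length-++⇒ P M p′ p<) ,
            subst (λ b → OccursAt (P ++ (M ++ z)) b (M ++ N)) (+-identityʳ (length P))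
              (occursAt-++ˡ P (M ++ z) 0 (M ++ N) Mz-starts)

    covered-sw-step : ∀ j → CoveredSw j → CoveredSw (suc j) → CoveredSw (suc (suc j))
    covered-sw-step j covered-j covered-1+j z z-starts p p< =
      subst (λ w → Covered w p) (sym (++-assoc P S₀ z)) covered
      where
      S₁ = s (suc j + suc n)
      S₀ = s (j + suc n)
      P = pow (a (suc (suc (j + suc n)))) S₁
      covered : Covered (P ++ (S₀ ++ z)) p
      covered with <⊎offset (length P) p
      ... | inj₁ p<P = covered-pow-block (a (suc (suc (j + suc n)))) S₁ covered-1+j
            (sw-starts-with (suc j)) (S₀ ++ z) (occursAt-++ S₀ z 0 N (sw-starts-with j)) p p<P
      ... | inj₂ (p′ , refl) = covered-++ˡ P _ p′ (covered-j z z-starts p′ (<length-++⇒ P S₀ p′ p<))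

    covered-sw : ∀ j → CoveredSw j
    covered-sw zero z z-starts p p< = 0 , NN , z≤n , p< , occursAt-++-prefix N z N z-starts
    covered-sw (suc zero) = covered-sw-1
    covered-sw (suc (suc j)) = covered-sw-step j (covered-sw j) (covered-sw (suc j))

    OccursInC : ℕ → List Bool → Set
    OccursInC b u = ∀ i → i < length u → c (b + i) ≡ at u i

    -- c_α starts with s_{p+n+3}, which starts with s_{p+n+2} s_{n+1}, long enough to contain p.
    c-covered : ∀ p → CoveredBy OccursInC p
    c-covered p with covered-sw (suc p) N (occursAt-self N) p p<S₁
      where
      S₁ = s (suc p + suc n)
      p<S₁ : p < length S₁
      p<S₁ = <-≤-trans (≤-<-trans (m≤m+n p (suc n)) (n<1+n (p + suc n)))
        (≤-trans (n≤q (suc p + suc n)) (≤-reflexive (sym (length-sw (suc p + suc n)))))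
    ... | b , β , b≤p , p<b+r , (fits , h) = b , β , b≤p , p<b+r , λ i i< →
          trans (c≡w (b + i) (<-≤-trans (+-monoʳ-< b i<) fits)) (h i i<)
      where
      S₁ = s (suc p + suc n)
      S₀ = s (p + suc n)
      w = S₁ ++ N
      K = suc (p + suc n)
      w-prefix : OccursAt (s (suc K)) 0 w
      w-prefix = pow-++-starts-with-block (a (suc K)) S₁ S₀ (slope K) (sw-starts-with (suc p)) (sw-starts-with p)
      c≡w : ∀ t → t < length w → c t ≡ at w t
      c≡w t t<w = trans (c≡sw K t (<-≤-trans t<w (≤-trans (proj₁ w-prefix) (≤-reflexive (length-sw (suc K))))))
        (proj₂ w-prefix t t<w)

  at-sw-prefix : ∀ k t → t < length (s k) → 2 ≤ length (s k) → at (s k) t ≡ at (s (suc k)) t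
  at-sw-prefix zero t _ (s≤s ())
  at-sw-prefix (suc k) t t< _ = sym (at-sw-suc k t (subst (t <_) (length-sw (suc k)) t<))

  -- Level n treats level n + 1 of the paper: ω = s_{n+1}^ω, of period Q = q_{n+1}.
  module Level (n Q′ : ℕ) (|N|≡Q : length (s (suc n)) ≡ suc Q′) where
    open Blocks n

    Q : ℕ
    Q = suc Q′

    ω : Word
    ω t = at N (t % Q)

    ω≡N : ∀ t → t < QN → ω t ≡ at N t
    ω≡N t t< = cong (at N) (m<n⇒m%n≡m (subst (t <_) |N|≡Q t<))

    ω-periodic : Periodic Q ω
    ω-periodic t = cong (at N) ([m+n]%n≡m%n t Q)

    ω-+QN : ∀ x → ω (QN + x) ≡ ω x
    ω-+QN x = trans (cong ω (trans (cong (_+ x) |N|≡Q) (+-comm Q x))) (ω-periodic x)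

    ω-+pow : ∀ r x → ω (length (pow r N) + x) ≡ ω x
    ω-+pow zero x = refl
    ω-+pow (suc r) x = trans (cong ω (trans (cong (_+ x) (length-++ N)) (+-assoc QN _ x)))
                         (trans (ω-+QN _) (ω-+pow r x))

    at-pow-N : ∀ r z t → t < length (pow r N) → at (pow r N ++ z) t ≡ ω t
    at-pow-N (suc r) z t t< = trans (cong (λ l → at l t) (++-assoc N (pow r N) z)) at-N-pow
      where
      at-N-pow : at (N ++ (pow r N ++ z)) t ≡ ω t
      at-N-pow with <⊎offset QN t
      ... | inj₁ t<N = trans (at-++ˡ N _ t t<N) (sym (ω≡N t t<N))
      ... | inj₂ (t′ , refl) = trans (at-++ʳ N _ t′)
            (trans (at-pow-N r z t′ (<length-++⇒ N (pow r N) t′ t<)) (sym (ω-+QN t′)))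

    1≤QN : 1 ≤ QN
    1≤QN = subst (1 ≤_) (sym |N|≡Q) (s≤s z≤n)

    1≤QM : 1 ≤ QM
    1≤QM = subst (1 ≤_) (sym (length-sw n)) (q-positive n)

    QM≤QN : QM ≤ QN
    QM≤QN = subst₂ _≤_ (sym (length-sw n)) (sym (length-sw (suc n))) (q-≤-suc n)

    <Q⇒<QN : ∀ {i} → i < Q → i < QN
    <Q⇒<QN {i} i<Q = subst (i <_) (sym |N|≡Q) i<Q

    -- s_n s_{n+1} agrees with s_{n+1} s_n, hence with ω, except on its last two letters.
    at-MN : ∀ x → suc (suc x) < QN + QM → at (M ++ N) x ≡ ω x
    at-MN x x< = trans (sym (proj₁ (sw-swap n) x (subst (suc (suc x) <_) (sym (length-++ N)) x<))) at-NM
      where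
      at-NM : at (N ++ M) x ≡ ω x
      at-NM with <⊎offset QN x
      ... | inj₁ x<N = trans (at-++ˡ N M x x<N) (sym (ω≡N x x<N))
      ... | inj₂ (y , refl) = trans (at-++ʳ N M y) (trans (at-sw-prefix n y y<M (≤-trans (s≤s (s≤s z≤n)) y+2<M))
                                (trans (sym (ω≡N y (<-≤-trans y<M QM≤QN))) (sym (ω-+QN y))))
        where
        y+2<M : suc (suc y) < QM
        y+2<M = +-cancelˡ-< QN _ _ (subst (_< QN + QM) (sym (+-suc-suc QN y)) x<)
        y<M : y < QM
        y<M = <-trans (n<1+n y) (<-trans (n<1+n (suc y)) y+2<M)

    at-NN : ∀ x → x < QN + QN → at (N ++ N) x ≡ ω x
    at-NN x x< with <⊎offset QN x
    ... | inj₁ x<N = trans (at-++ˡ N N x x<N) (sym (ω≡N x x<N))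
    ... | inj₂ (y , refl) = trans (at-++ʳ N N y) (trans (sym (ω≡N y (+-cancelˡ-< QN _ _ x<))) (sym (ω-+QN y)))

    at-NMN : ∀ x → suc x < QN + QN → at (N ++ (M ++ N)) x ≡ ω x
    at-NMN x x< with <⊎offset QN x
    ... | inj₁ x<N = trans (at-++ˡ N _ x x<N) (sym (ω≡N x x<N))
    ... | inj₂ (y , refl) = trans (at-++ʳ N _ y) (trans (at-MN y y+2<) (sym (ω-+QN y)))
      where
      y+1<N : suc y < QN
      y+1<N = +-cancelˡ-< QN _ _ (subst (_< QN + QN) (sym (+-suc QN y)) x<)
      y+2< : suc (suc y) < QN + QM
      y+2< = subst (_< QN + QM) (+-comm (suc y) 1) (+-mono-<-≤ y+1<N 1≤QM)

    exceptional : Word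
    exceptional i = at (M ++ N) (QM ∸ 1 + i)

    c-factors : ∀ p → (∃ λ k → ∀ i → i < Q → c (p + i) ≡ ω (k + i))
      ⊎ ((∀ i → i < Q → c (p + i) ≡ exceptional i) × (∀ i → i < Q → c (suc p + i) ≡ ω i))
    c-factors p with c-covered p
    ... | b , β , b≤p , p<b+r , occurs = factor β p<b+r occurs
      where
      j = p ∸ b
      b+j≡p : b + j ≡ p
      b+j≡p = m+[n∸m]≡n b≤p
      c-at : ∀ i → c (p + i) ≡ c (b + (j + i))
      c-at i = cong c (trans (cong (_+ i) (sym b+j≡p)) (+-assoc b j i))
      j< : ∀ {L} → p < b + L → j < L
      j< {L} p< = +-cancelˡ-< b _ _ (subst (_< b + L) (sym b+j≡p) p<)
      factor : ∀ β → p < b + reach β → OccursInC b (block β) →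
        (∃ λ k → ∀ i → i < Q → c (p + i) ≡ ω (k + i))
        ⊎ ((∀ i → i < Q → c (p + i) ≡ exceptional i) × (∀ i → i < Q → c (suc p + i) ≡ ω i))
      factor NN p< occ = inj₁ (j , λ i i<Q → trans (c-at i)
        (trans (occ (j + i) (subst (j + i <_) (sym (length-++ N)) (j+i< i i<Q))) (at-NN (j + i) (j+i< i i<Q))))
        where
        j+i< : ∀ i → i < Q → j + i < QN + QN
        j+i< i i<Q = +-mono-< (j< p<) (<Q⇒<QN i<Q)
      factor NMN p< occ = inj₁ (j , λ i i<Q → trans (c-at i)
        (trans (occ (j + i) (j+i<NMN i i<Q)) (at-NMN (j + i) (j+i+1< i i<Q))))
        where
        j+i+1< : ∀ i → i < Q → suc (j + i) < QN + QN
        j+i+1< i i<Q = +-mono-≤-< (j< p<) (<Q⇒<QN i<Q)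
        j+i<NMN : ∀ i → i < Q → j + i < length (N ++ (M ++ N))
        j+i<NMN i i<Q = <-≤-trans (<-trans (n<1+n _) (j+i+1< i i<Q)) (≤-trans (+-monoʳ-≤ QN (m≤n+m QN QM))
          (≤-reflexive (sym (trans (length-++ N) (cong (QN +_) (length-++ M))))))
      factor MN p< occ with m≤n⇒m<n∨m≡n (j< {QM} p<)
      ... | inj₁ j+1<M = inj₁ (j , λ i i<Q → trans (c-at i)
            (trans (occ (j + i) (j+i<MN i i<Q)) (at-MN (j + i) (j+i+2< i i<Q))))
        where
        j+i<MN : ∀ i → i < Q → j + i < length (M ++ N)
        j+i<MN i i<Q = subst (j + i <_) (sym (length-++ M)) (+-mono-< (j< p<) (<Q⇒<QN i<Q))
        j+i+2< : ∀ i → i < Q → suc (suc (j + i)) < QN + QM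
        j+i+2< i i<Q = subst (_≤ QN + QM) (+-suc (suc (suc j)) i)
          (subst (suc (suc j) + suc i ≤_) (+-comm QM QN) (+-mono-≤ j+1<M (<Q⇒<QN i<Q)))
      ... | inj₂ j+1≡M = inj₂ (
            (λ i i<Q → trans (c-at i) (trans (occ (j + i) (j+i<MN i i<Q))
              (cong (λ z → at (M ++ N) (z + i)) (cong ℕ.pred j+1≡M)))) ,
            (λ i i<Q → trans (cong c (sym (b+M+i i))) (trans (occ (QM + i) (M+i<MN i i<Q))
              (trans (at-++ʳ M N i) (sym (ω≡N i (<Q⇒<QN i<Q)))))))
        where
        j+i<MN : ∀ i → i < Q → j + i < length (M ++ N)
        j+i<MN i i<Q = subst (j + i <_) (sym (length-++ M)) (+-mono-< (j< p<) (<Q⇒<QN i<Q))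
        M+i<MN : ∀ i → i < Q → QM + i < length (M ++ N)
        M+i<MN i i<Q = subst (QM + i <_) (sym (length-++ M)) (+-monoʳ-< QM (<Q⇒<QN i<Q))
        b+M+i : ∀ i → b + (QM + i) ≡ suc p + i
        b+M+i i = trans (cong (λ z → b + (z + i)) (sym j+1≡M))
          (trans (+-suc b (j + i)) (cong suc (trans (sym (+-assoc b j i)) (cong (_+ i) b+j≡p))))

    ones-ω : ones ω Q ≡ pp (suc (suc n))
    ones-ω = trans (ones-cong ω (at N) Q (λ i i<Q → ω≡N i (<Q⇒<QN i<Q)))
      (trans (cong (ones (at N)) (sym |N|≡Q)) (trans (ones-at N) (countOnes-sw (suc n))))

    ω-primitive : ∀ j j′ → j < j′ → j′ < Q → ¬ (∀ i → i < Q′ → ω (j + i) ≡ ω (j′ + i))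
    ω-primitive j j′ j<j′ j′<Q agree = <-irrefl refl (begin-strict
      Q      ≡⟨ sym g≡Q ⟩
      g      ≤⟨ ∣⇒≤ {{>-nonZero (m<n⇒0<n∸m j<j′)}} (proj₁ (GCD.commonDivisor g-gcd)) ⟩
      D      ≤⟨ m≤n+m D j ⟩
      j + D  ≡⟨ sym j′≡j+D ⟩
      j′     <⟨ j′<Q ⟩
      Q      ∎)
      where
      open ≤-Reasoning
      D = j′ ∸ j
      j′≡j+D : j′ ≡ j + D
      j′≡j+D = sym (m+[n∸m]≡n (<⇒≤ j<j′))
      D-period : Periodic D ω
      D-period = periodic-≡ (λ x → ω (x + D)) ω (periodic-shiftʳ ω ω-periodic D) ω-periodic j
        (λ i i<Q → trans (cong ω (trans (+-swapʳ j i D) (cong (_+ i) (sym j′≡j+D))))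
          (sym (periodic-agree-last ω ω-periodic j j′ agree i i<Q)))
      g = proj₁ (periodic-gcd ω D Q D-period ω-periodic)
      g-gcd = proj₁ (proj₂ (periodic-gcd ω D Q D-period ω-periodic))
      g≡Q : g ≡ Q
      g≡Q = coprime-ones⇒divisor-period≡ ω Q
        (λ k k∣Q k∣ones → qq-pp-coprime (suc n) k (subst (k ∣_) (trans (sym |N|≡Q) (length-sw (suc n))) k∣Q)
          (subst (k ∣_) ones-ω k∣ones))
        g (proj₂ (GCD.commonDivisor g-gcd)) (proj₂ (proj₂ (periodic-gcd ω D Q D-period ω-periodic)))

    ω-windows-distinct : ∀ m′ → Q ≤ suc (suc m′) → ∀ j j′ → j < Q → j′ < Q →
      pre (suc m′) (λ i → ω (j + i)) ≡ pre (suc m′) (λ i → ω (j′ + i)) → j ≡ j′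
    ω-windows-distinct m′ Q≤ j j′ j<Q j′<Q eq with <-cmp j j′
    ... | tri≈ _ j≡j′ _ = j≡j′
    ... | tri< j<j′ _ _ = ⊥-elim (ω-primitive j j′ j<j′ j′<Q
            (λ i i< → pre-≡⇒≡ (suc m′) _ _ eq i (<-≤-trans i< (≤-pred Q≤))))
    ... | tri> _ _ j′<j = ⊥-elim (ω-primitive j′ j j′<j j<Q
            (λ i i< → sym (pre-≡⇒≡ (suc m′) _ _ eq i (<-≤-trans i< (≤-pred Q≤)))))

    aₙ₊₂ : ℕ
    aₙ₊₂ = a (suc (suc n))

    P : List Bool
    P = pow aₙ₊₂ N

    LP : ℕ
    LP = length P

    c≡PMN : ∀ t → t < length (P ++ (M ++ N)) → c t ≡ at (P ++ (M ++ N)) t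
    c≡PMN t t< = trans (c≡sw (suc (suc n)) t t<q) (trans (proj₂ starts t t<S₂N) (cong (λ l → at l t) (++-assoc P M N)))
      where
      S₂ = s (suc (suc n))
      starts : OccursAt (s (suc (suc (suc n)))) 0 (S₂ ++ N)
      starts = pow-++-starts-with-block (a (suc (suc (suc n)))) S₂ N (slope (suc (suc n)))
                 (sw-starts-with 1) (sw-starts-with 0)
      t<S₂N : t < length (S₂ ++ N)
      t<S₂N = subst (t <_) (cong length (sym (++-assoc P M N))) t<
      t<q : t < q a (suc (suc (suc n)))
      t<q = <-≤-trans t<S₂N (≤-trans (proj₁ starts) (≤-reflexive (length-sw (suc (suc (suc n))))))

    length-PMN : length (P ++ (M ++ N)) ≡ LP + (QM + QN)
    length-PMN = trans (length-++ P) (cong (LP +_) (length-++ M))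

    c≡MN : ∀ t → t < QM + QN → c (LP + t) ≡ at (M ++ N) t
    c≡MN t t< = trans (c≡PMN (LP + t) (subst (LP + t <_) (sym length-PMN) (+-monoʳ-< LP t<))) (at-++ʳ P (M ++ N) t)

    c≡ω : ∀ t → suc (suc t) < LP + (QN + QM) → c t ≡ ω t
    c≡ω t t+2< with <⊎offset LP t
    ... | inj₁ t<P = trans (c≡PMN t (<-≤-trans t<P (≤-trans (m≤m+n LP _) (≤-reflexive (sym length-PMN)))))
                       (at-pow-N aₙ₊₂ (M ++ N) t t<P)
    ... | inj₂ (t′ , refl) = trans (c≡MN t′ t′<)
                               (trans (at-MN t′ t′+2<) (sym (ω-+pow aₙ₊₂ t′)))
      where
      t′+2< : suc (suc t′) < QN + QM
      t′+2< = +-cancelˡ-< LP _ _ (subst (_< LP + (QN + QM)) (sym (+-suc-suc LP t′)) t+2<)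
      t′< : t′ < QM + QN
      t′< = subst (t′ <_) (+-comm QN QM) (<-trans (n<1+n t′) (<-trans (n<1+n (suc t′)) t′+2<))

    ω≡NM-end : ∀ t → suc (suc t) ≡ QN + QM → ω t ≡ at (N ++ M) t
    ω≡NM-end t t+2≡ with <⊎offset QN t
    ... | inj₁ t<N = trans (ω≡N t t<N) (sym (at-++ˡ N M t t<N))
    ... | inj₂ (y , refl) = trans (ω-+QN y) (trans (ω≡N y (<-≤-trans y<M QM≤QN))
                              (trans (sym (at-sw-prefix n y y<M 2≤M)) (sym (at-++ʳ N M y))))
      where
      y+2≡M : suc (suc y) ≡ QM
      y+2≡M = +-cancelˡ-≡ QN _ _ (trans (+-suc-suc QN y) t+2≡)
      y<M : y < QM
      y<M = subst (y <_) y+2≡M (<-trans (n<1+n y) (n<1+n (suc y)))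
      2≤M : 2 ≤ QM
      2≤M = subst (2 ≤_) y+2≡M (s≤s (s≤s z≤n))

    -- For l ≥ 1 the break is at the last-but-one letter of s_n s_{n+1}, read one period earlier.
    c-breaks-l≥1 : ∀ d l m′ → aₙ₊₂ ≡ d + suc l → suc l * QN + QM ≤ suc (suc m′)
      → ∃ λ t → t < suc m′ × (c (d * QN + t) ≢ c (d * QN + t + QN))
    c-breaks-l≥1 d l m′ a≡ upper with <⊎offset 2 (QN + QM)
    ... | inj₁ NM<2 = ⊥-elim (<-irrefl refl (<-≤-trans NM<2 (+-mono-≤ 1≤QN 1≤QM)))
    ... | inj₂ (t₀ , NM≡) = l * QN + t₀ , t< , λ eq →
          proj₁ (proj₂ (sw-swap n)) t₀ (trans (sym NM≡) (sym (length-++ N))) (trans (sym c-at-x) (trans eq c-at-x+Q))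
      where
      L₀ = length (pow (d + l) N)
      x = d * QN + (l * QN + t₀)
      x≡ : x ≡ L₀ + t₀
      x≡ = trans (sym (+-assoc (d * QN) (l * QN) t₀))
             (cong (_+ t₀) (sym (trans (length-pow (d + l) N) (*-distribʳ-+ QN d l))))
      LP≡ : LP ≡ QN + L₀
      LP≡ = trans (cong (λ z → length (pow z N)) (trans a≡ (+-suc d l))) (length-++ N)
      t< : l * QN + t₀ < suc m′
      t< = s≤s (≤-pred (≤-pred (≤-trans (≤-reflexive lt₀+2≡) upper)))
        where
        lt₀+2≡ : suc (suc (l * QN + t₀)) ≡ suc l * QN + QM
        lt₀+2≡ = trans (sym (+-suc-suc (l * QN) t₀)) (trans (cong (l * QN +_) (sym NM≡))
                   (trans (sym (+-assoc (l * QN) QN QM)) (cong (_+ QM) (+-comm (l * QN) QN))))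
      x+2< : suc (suc x) < LP + (QN + QM)
      x+2< = subst₂ _<_ (sym x+2≡) (sym (cong (_+ (QN + QM)) LP≡)) (+-monoˡ-< (QN + QM) (m<n+m L₀ 1≤QN))
        where
        x+2≡ : suc (suc x) ≡ L₀ + (QN + QM)
        x+2≡ = trans (cong (λ z → suc (suc z)) x≡) (trans (sym (+-suc-suc L₀ t₀)) (cong (L₀ +_) (sym NM≡)))
      c-at-x : c x ≡ at (N ++ M) t₀
      c-at-x = trans (c≡ω x x+2<) (trans (cong ω x≡) (trans (ω-+pow (d + l) t₀) (ω≡NM-end t₀ (sym NM≡))))
      c-at-x+Q : c (x + QN) ≡ at (M ++ N) t₀
      c-at-x+Q = trans (cong c (trans (cong (_+ QN) x≡) (trans (+-swapʳ L₀ t₀ QN)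
                   (trans (cong (_+ t₀) (+-comm L₀ QN)) (cong (_+ t₀) (sym LP≡))))))
                   (c≡MN t₀ (subst (t₀ <_) (trans (sym NM≡) (+-comm QN QM)) (<-trans (n<1+n t₀) (n<1+n (suc t₀)))))

    -- For l = 0 the break is inside s_n s_{n+1} itself, at its last-but-one letter when
    -- q_n ≥ 2 and at its last letter when q_n = 1.
    c-breaks-l≡0 : ∀ d m′ → aₙ₊₂ ≡ d → QN ≤ suc (suc m′)
      → ∃ λ t → t < suc m′ × (c (d * QN + t) ≢ c (d * QN + t + QN))
    c-breaks-l≡0 d m′ a≡ lower with <⊎offset 2 QM
    ... | inj₁ M<2 = 0 , s≤s z≤n , λ eq → proj₂ (proj₂ (sw-swap n)) QN QN+1≡ (trans (sym c-at-0) (trans eq c-at-Q))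
      where
      QM≡1 : QM ≡ 1
      QM≡1 = ≤-antisym (≤-pred M<2) 1≤QM
      dQ≡LP : d * QN + 0 ≡ LP + 0
      dQ≡LP = cong (_+ 0) (trans (cong (_* QN) (sym a≡)) (sym (length-pow aₙ₊₂ N)))
      QN+1≡ : suc QN ≡ length (N ++ M)
      QN+1≡ = trans (trans (+-comm 1 QN) (cong (QN +_) (sym QM≡1))) (sym (length-++ N))
      c-at-0 : c (d * QN + 0) ≡ at (N ++ M) QN
      c-at-0 = trans (cong c dQ≡LP) (trans (c≡MN 0 (≤-trans 1≤QM (m≤m+n QM QN))) (trans (at-++ˡ M N 0 1≤QM)
                 (trans (sym (at-++ʳ N M 0)) (cong (at (N ++ M)) (+-identityʳ QN)))))
      c-at-Q : c (d * QN + 0 + QN) ≡ at (M ++ N) QN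
      c-at-Q = trans (cong c (trans (cong (_+ QN) dQ≡LP) (+-assoc LP 0 QN)))
                 (c≡MN QN (subst (QN <_) (+-comm QN QM) (m<m+n QN 1≤QM)))
    ... | inj₂ (t₀ , M≡) = t₀ , t< , λ eq →
          proj₁ (proj₂ (sw-swap n)) (QN + t₀) NM≡ (trans (sym c-at-t) (trans eq c-at-t+Q))
      where
      dQ≡LP : ∀ y → d * QN + y ≡ LP + y
      dQ≡LP y = cong (_+ y) (trans (cong (_* QN) (sym a≡)) (sym (length-pow aₙ₊₂ N)))
      t₀<M : t₀ < QM
      t₀<M = subst (t₀ <_) (sym M≡) (<-trans (n<1+n t₀) (n<1+n (suc t₀)))
      t< : t₀ < suc m′
      t< = s≤s (≤-pred (≤-pred (≤-trans (≤-reflexive (sym M≡)) (≤-trans QM≤QN lower))))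
      NM≡ : suc (suc (QN + t₀)) ≡ length (N ++ M)
      NM≡ = trans (sym (+-suc-suc QN t₀)) (trans (cong (QN +_) (sym M≡)) (sym (length-++ N)))
      c-at-t : c (d * QN + t₀) ≡ at (N ++ M) (QN + t₀)
      c-at-t = trans (cong c (dQ≡LP t₀)) (trans (c≡MN t₀ (≤-trans t₀<M (m≤m+n QM QN)))
                 (trans (at-++ˡ M N t₀ t₀<M) (sym (at-++ʳ N M t₀))))
      c-at-t+Q : c (d * QN + t₀ + QN) ≡ at (M ++ N) (QN + t₀)
      c-at-t+Q = trans (cong c (trans (cong (_+ QN) (dQ≡LP t₀)) (trans (+-assoc LP t₀ QN) (cong (LP +_) (+-comm t₀ QN)))))
                   (c≡MN (QN + t₀) (subst (QN + t₀ <_) (+-comm QN QM) (+-monoʳ-< QN t₀<M)))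

    InI-lower : ∀ l m′ → InI a (suc n) l (suc m′) → QN ≤ suc (suc m′)
    InI-lower zero m′ (lower , _) = subst₂ _≤_ (sym (length-sw (suc n))) (+-comm (suc m′) 1) lower
    InI-lower (suc l) m′ (lower , _) = ≤-trans (≤-trans (m≤m+n QN (l * QN)) (m≤m+n (suc l * QN) QM))
      (subst₂ _≤_ (cong₂ _+_ (cong (suc l *_) (sym (length-sw (suc n)))) (sym (length-sw n)))
        (+-comm (suc m′) 1) lower)

    InI-upper : ∀ l m′ → InI a (suc n) l (suc m′) → suc (suc (suc m′)) ≤ suc l * QN + QM
    InI-upper zero m′ (_ , upper) = subst₂ _≤_ (+-comm (suc m′) 2)
      (cong₂ _+_ (trans (sym (length-sw (suc n))) (sym (+-identityʳ QN))) (sym (length-sw n))) upper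
    InI-upper (suc l) m′ (_ , upper) = subst₂ _≤_ (+-comm (suc m′) 2)
      (cong₂ _+_ (cong (suc (suc l) *_) (sym (length-sw (suc n)))) (sym (length-sw n))) upper

    c-breaks : ∀ d l m′ → aₙ₊₂ ≡ d + l → InI a (suc n) l (suc m′)
      → ∃ λ t → t < suc m′ × (c (d * QN + t) ≢ c (d * QN + t + QN))
    c-breaks d zero m′ a≡ inI = c-breaks-l≡0 d m′ (trans a≡ (+-identityʳ d)) (InI-lower zero m′ inI)
    c-breaks d (suc l) m′ a≡ (lower , _) = c-breaks-l≥1 d l m′ a≡
      (subst₂ _≤_ (cong₂ _+_ (cong (suc l *_) (sym (length-sw (suc n)))) (sym (length-sw n)))
        (+-comm (suc m′) 1) lower)

  turns-exactly-level-suc : ∀ n l m′ → l < a (suc (suc n)) → InI a (suc n) l (suc m′) →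
    TurnsExactly c (suc m′) (q a (suc n)) (a (suc (suc n)) ∸ l)
  turns-exactly-level-suc n l m′ l<a inI = turns-exactly (q a (suc n)) (aₙ₊₂ ∸ l) q≡Q d≡
    where
    Q′ = ℕ.pred (length (s (suc n)))
    |N|≡Q : length (s (suc n)) ≡ suc Q′
    |N|≡Q = sym (suc-pred _ {{>-nonZero (subst (0 <_) (sym (length-sw (suc n))) (q-positive (suc n)))}})
    open Blocks n
    open Level n Q′ |N|≡Q
    d′ = ℕ.pred (aₙ₊₂ ∸ l)
    d≡ : aₙ₊₂ ∸ l ≡ suc d′
    d≡ = sym (suc-pred _ {{>-nonZero (m<n⇒0<n∸m l<a)}})
    a≡ : aₙ₊₂ ≡ suc d′ + l
    a≡ = trans (sym (m∸n+n≡m (<⇒≤ l<a))) (cong (_+ l) d≡)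
    q≡Q : q a (suc n) ≡ suc Q′
    q≡Q = trans (sym (length-sw (suc n))) |N|≡Q
    Q≤1+m : suc Q′ ≤ suc (suc m′)
    Q≤1+m = subst (_≤ suc (suc m′)) |N|≡Q (InI-lower l m′ inI)
    c≡ω-prefix : ∀ t → t < suc d′ * suc Q′ + suc m′ → c t ≡ ω t
    c≡ω-prefix t t< = c≡ω t (begin-strict
      suc (suc t)                           <⟨ s≤s (s≤s t<) ⟩
      suc (suc (suc d′ * suc Q′ + suc m′))  ≡⟨ sym (+-suc-suc (suc d′ * suc Q′) (suc m′)) ⟩
      suc d′ * suc Q′ + suc (suc (suc m′))  ≡⟨ cong (λ z → suc d′ * z + suc (suc (suc m′))) (sym |N|≡Q) ⟩
      suc d′ * QN + suc (suc (suc m′))      ≤⟨ +-monoʳ-≤ (suc d′ * QN) (InI-upper l m′ inI) ⟩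
      suc d′ * QN + (suc l * QN + QM)       ≡⟨ block-length (suc d′) l QN QM ⟩
      (suc d′ + l) * QN + (QN + QM)         ≡⟨ cong (λ z → z * QN + (QN + QM)) (sym a≡) ⟩
      aₙ₊₂ * QN + (QN + QM)                 ≡⟨ cong (_+ (QN + QM)) (sym (length-pow aₙ₊₂ N)) ⟩
      LP + (QN + QM)                        ∎)
      where open ≤-Reasoning
    breaks : ∃ λ t → t < suc m′ × (c (suc d′ * suc Q′ + t) ≢ c (suc d′ * suc Q′ + t + suc Q′))
    breaks = subst (λ z → ∃ λ t → t < suc m′ × (c (suc d′ * z + t) ≢ c (suc d′ * z + t + z))) |N|≡Q
      (c-breaks (suc d′) l m′ a≡ inI)
    open PeriodicPrefix c ω exceptional Q′ m′ d′ Q≤1+m ω-periodic c≡ω-prefix (ω-windows-distinct m′ Q≤1+m)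
      c-factors breaks using (turns-exactly)

  length-s₁ : length (s 1) ≡ suc (a 1 ∸ 1)
  length-s₁ = trans (length-sw 1) (trans (+-identityʳ (a 1 * 1))
    (trans (*-identityʳ (a 1)) (sym (suc-pred (a 1) {{>-nonZero (slope 0)}}))))

  at-s₁-zeros : ∀ z j → j < a 1 ∸ 1 → at (s 1 ++ z) j ≡ false
  at-s₁-zeros z j j< = trans (cong (λ l → at l j) (++-assoc (zeros (a 1 ∸ 1)) (true ∷ []) z))
    (at-zeros (a 1 ∸ 1) (true ∷ z) j j<)

  at-s₁-after : ∀ z → at (s 1 ++ z) (suc (a 1 ∸ 1)) ≡ at z 0
  at-s₁-after z = trans (cong (λ l → at l (suc (a 1 ∸ 1))) (++-assoc (zeros (a 1 ∸ 1)) (true ∷ []) z))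
    (trans (cong (at (zeros (a 1 ∸ 1) ++ (true ∷ z))) (+-comm 1 (a 1 ∸ 1))) (at-zeros-+ (a 1 ∸ 1) (true ∷ z) 1))

  -- The only 1 of s_1 = 0^{a_1 - 1} 1 is its last letter, and every block continues with a 0.
  one-followed-by-zero : 1 ≤ a 1 ∸ 1 → ∀ p → c p ≡ true → c (suc p) ≡ false
  one-followed-by-zero 1≤b p c-p with Blocks.c-covered 0 p
  ... | b , β , b≤p , p< , occ = after β p< occ
    where
    open Blocks 0
    j = p ∸ b
    b+j≡p : b + j ≡ p
    b+j≡p = m+[n∸m]≡n b≤p
    j< : ∀ {L} → p < b + L → j < L
    j< {L} p< = +-cancelˡ-< b _ _ (subst (_< b + L) (sym b+j≡p) p<)
    true≢false : true ≢ false
    true≢false ()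
    after-N : ∀ X → at X 0 ≡ false → j < QN → OccursInC b (N ++ X) → suc QN ≤ length (N ++ X) → c (suc p) ≡ false
    after-N X X-starts j<N occ N<NX with <⊎offset (a 1 ∸ 1) j
    ... | inj₁ j<b = ⊥-elim (true≢false (trans (sym c-p) (trans (cong c (sym b+j≡p))
            (trans (occ j (<-trans j<N N<NX)) (at-s₁-zeros X j j<b)))))
    ... | inj₂ (y , j≡) = begin
      c (suc p)                       ≡⟨ cong c (trans (cong suc (sym b+j≡p)) (sym (+-suc b j))) ⟩
      c (b + suc j)                   ≡⟨ cong (λ z → c (b + suc z)) j≡b ⟩
      c (b + suc (a 1 ∸ 1))           ≡⟨ occ (suc (a 1 ∸ 1)) (subst (_< length (N ++ X)) length-s₁ N<NX) ⟩
      at (N ++ X) (suc (a 1 ∸ 1))     ≡⟨ at-s₁-after X ⟩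
      at X 0                          ≡⟨ X-starts ⟩
      false                           ∎
      where
      open ≡-Reasoning
      j≡b : j ≡ a 1 ∸ 1
      j≡b = ≤-antisym (≤-pred (subst (j <_) length-s₁ j<N)) (subst (a 1 ∸ 1 ≤_) (sym j≡) (m≤m+n (a 1 ∸ 1) y))
    N<N++ : ∀ X → 1 ≤ length X → suc QN ≤ length (N ++ X)
    N<N++ X 1≤X = subst (suc QN ≤_) (sym (length-++ N)) (subst (_≤ QN + length X) (+-comm QN 1) (+-monoʳ-≤ QN 1≤X))
    after : ∀ β → p < b + reach β → OccursInC b (block β) → c (suc p) ≡ false
    after NN p< occ = after-N N (trans (cong (λ l → at l 0) (sym (++-identityʳ N))) (at-s₁-zeros [] 0 1≤b))
      (j< p<) occ (N<N++ N (subst (1 ≤_) (sym length-s₁) (s≤s z≤n)))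
    after NMN p< occ = after-N (M ++ N) refl (j< p<) occ (N<N++ (M ++ N) (s≤s z≤n))
    after MN p< occ = ⊥-elim (true≢false (trans (sym c-p)
      (trans (cong c (trans (sym b+j≡p) (cong (b +_) j≡0))) (occ 0 (s≤s z≤n)))))
      where
      j≡0 : j ≡ 0
      j≡0 = ≤-antisym (≤-pred (j< {QM} p<)) z≤n

  -- At level 0 the period is q_0 = 1, ω = 0^ω and the exceptional factor is 1.
  turns-exactly-level-0 : ∀ l m′ → l < a 1 → InI a 0 l (suc m′) → TurnsExactly c (suc m′) (q a 0) (a 1 ∸ l)
  turns-exactly-level-0 zero m′ _ (_ , upper) with subst (_≤ 1) (+-comm (suc m′) 2) upper
  ... | s≤s ()
  turns-exactly-level-0 (suc l) m′ l<a (lower , upper) with ≤-antisym (≤-pred l≤) (≤-pred (≤-pred l≥))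
    where
    l≤ : suc l ≤ suc (suc m′)
    l≤ = subst₂ _≤_ (trans (+-identityʳ _) (*-identityʳ (suc l))) (+-comm (suc m′) 1) lower
    l≥ : suc (suc (suc m′)) ≤ suc (suc l)
    l≥ = subst₂ _≤_ (+-comm (suc m′) 2) (trans (+-identityʳ _) (*-identityʳ (suc (suc l)))) upper
  ... | refl = turns-exactly (q a 0) (a 1 ∸ suc (suc m′)) refl d≡
    where
    b = a 1 ∸ 1
    d′ = ℕ.pred (a 1 ∸ suc (suc m′))
    d≡ : a 1 ∸ suc (suc m′) ≡ suc d′
    d≡ = sym (suc-pred _ {{>-nonZero (m<n⇒0<n∸m l<a)}})
    d+m≡b : suc d′ * 1 + suc m′ ≡ b
    d+m≡b = trans (cong (_+ suc m′) (*-identityʳ (suc d′))) (suc-injective (begin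
      suc (suc d′ + suc m′)         ≡⟨ sym (+-suc (suc d′) (suc m′)) ⟩
      suc d′ + suc (suc m′)         ≡⟨ cong (_+ suc (suc m′)) (sym d≡) ⟩
      a 1 ∸ suc (suc m′) + suc (suc m′) ≡⟨ m∸n+n≡m (<⇒≤ l<a) ⟩
      a 1                           ≡⟨ sym (suc-pred (a 1) {{>-nonZero (slope 0)}}) ⟩
      suc b                         ∎))
      where open ≡-Reasoning
    b<q₁ : b < q a 1
    b<q₁ = subst (b <_) (trans (sym length-s₁) (length-sw 1)) (n<1+n b)
    prefix-zeros : ∀ t → t < suc d′ * 1 + suc m′ → c t ≡ false
    prefix-zeros t t< = trans (c≡sw 0 t (<-trans t<b b<q₁)) (at-zeros b (true ∷ []) t t<b)
      where
      t<b : t < b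
      t<b = subst (t <_) d+m≡b t<
    distinct : ∀ j j′ → j < 1 → j′ < 1 → pre (suc m′) (λ i → false) ≡ pre (suc m′) (λ i → false) → j ≡ j′
    distinct zero zero _ _ _ = refl
    distinct (suc _) _ (s≤s ()) _ _
    distinct zero (suc _) _ (s≤s ()) _
    factors : ∀ p → (∃ λ k → ∀ i → i < 1 → c (p + i) ≡ false)
      ⊎ ((∀ i → i < 1 → c (p + i) ≡ true) × (∀ i → i < 1 → c (suc p + i) ≡ false))
    factors p with c p in c-p
    ... | false = inj₁ (0 , λ { zero _ → trans (cong c (+-identityʳ p)) c-p ; (suc _) (s≤s ()) })
    ... | true = inj₂ ((λ { zero _ → trans (cong c (+-identityʳ p)) c-p ; (suc _) (s≤s ()) }) ,
                       (λ { zero _ → trans (cong c (+-identityʳ (suc p)))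
                              (one-followed-by-zero (subst (1 ≤_) d+m≡b (s≤s z≤n)) p c-p)
                          ; (suc _) (s≤s ()) }))
    breaks : ∃ λ t → t < suc m′ × (c (suc d′ * 1 + t) ≢ c (suc d′ * 1 + t + 1))
    breaks = m′ , n<1+n m′ , λ eq → false≢true (trans (sym c-at-x) (trans eq c-at-x+1))
      where
      false≢true : false ≢ true
      false≢true ()
      x = suc d′ * 1 + m′
      c-at-x : c x ≡ false
      c-at-x = prefix-zeros x (+-monoʳ-< (suc d′ * 1) (n<1+n m′))
      c-at-x+1 : c (x + 1) ≡ true
      c-at-x+1 = trans (cong c (trans (trans (+-assoc (suc d′ * 1) m′ 1) (cong (suc d′ * 1 +_) (+-comm m′ 1))) d+m≡b))
        (trans (c≡sw 0 b b<q₁) (trans (cong (at (s 1)) (sym (+-identityʳ b))) (at-zeros-+ b (true ∷ []) 0)))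
    open PeriodicPrefix c (λ _ → false) (λ _ → true) 0 m′ d′ (s≤s z≤n) (λ _ → refl) prefix-zeros distinct
      factors breaks using (turns-exactly)

mainTheorem2 : (a : ℕ → ℕ) → IsSlope a → (n l m : ℕ) → l < a (suc n) → 1 ≤ m → InI a n l m →
    Σ (Cycle (charWord a) m) (λ C → len C ≡ q a n)
    × ((C : Cycle (charWord a) m) → len C ≡ q a n →
        TurnsTimes (charWord a) C (a (suc n) ∸ l)
        × ¬ TurnsTimes (charWord a) C (suc (a (suc n) ∸ l)))
mainTheorem2 a slope zero l (suc m′) l<a _ inI = StandardWords.turns-exactly-level-0 a slope l m′ l<a inI
mainTheorem2 a slope (suc n) l (suc m′) l<a _ inI = StandardWords.turns-exactly-level-suc a slope n l m′ l<a inI
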